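{- For the process defined in the context, for any $t\geq1$ and any $\mathcal I^*\subset\{1,\ldots,m\}\times\{1,\ldots,k\}$, almost surely $$\mathbb E\Big[\prod_{(i,j)\in\mathcal I^*}K_t^*(i,j)\,\Big|\,\mathcal F_{t-1}\Big]\leq\max\{1,|V\setminus(\mathcal A_{t-1}\cup\mathcal N_{t-1})|\}^{ -|\mathcal I^*|}.$$
   Context: Setting: $k\geq k_0$ for a sufficiently large constant $k_0$, $k^{ -2}\leq\rho<1/25$, $m=\lceil\rho 2^k n/k\rceil$, $\lambda=\sqrt k$, $k_1=0.49k$. $\Phi=\Phi_1\wedge\cdots\wedge\Phi_m$ is a uniformly random $k$-CNF over $V=\{x_1,\ldots,x_n\}$: an ordered $m$-tuple of clauses $\Phi_i=\Phi_{i1}\vee\cdots\vee\Phi_{ik}$ whose $km$ literals are independent uniform over the $2n$ literals. $|l|$ is the variable of literal $l$, $\mathrm{sign}(l)=\pm1$ according as $l$ is positive/negative. For $S\subset V$, $\Phi_i$ is $S$-negative if $|\Phi_{ij}|\in S$ for every $j$ with $\mathrm{sign}(\Phi_{ij})=1$. Process: $\sigma_0\equiv 1$, $\mathcal A_0=\mathcal N_0=\mathcal Z_0=\emptyset$, $\pi_0(i,j)=\mathrm{sign}(\Phi_{ij})$. For $t=1,2,\ldots$: (PI0) if $\sigma_{t-1}$ satisfies $\Phi$, stop (stopping time $T$). (PI1) choose $i_t$ uniformly among indices of clauses unsatisfied under $\sigma_{t-1}$ and $j_t\in\{1,\ldots,k\}$ uniformly; $\sigma_t$ is $\sigma_{t-1}$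 with the value of $y_t=|\Phi_{i_tj_t}|$ flipped. (PI2) set $\mathcal Z_t=\mathcal Z_{t-1}$, $\mathcal N_t=\mathcal N_{t-1}$; while there is $i\notin\mathcal Z_t$ such that $\Phi_i$ is $(\mathcal A_{t-1}\cup\mathcal N_t\cup\{y_t\})$-negative and either at least $k_1$ indices $j$ have $|\Phi_{ij}|\in\mathcal A_{t-1}\cup\{y_t\}$ or more than $\lambda$ indices $j$ have $|\Phi_{ij}|\in\mathcal N_t$, add the least such $i$ to $\mathcal Z_t$ and all variables of $\Phi_i$ to $\mathcal N_t$. (PI3) $\mathcal A_t=(\mathcal A_{t-1}\cup\{y_t\})\setminus\mathcal N_t$, and $\pi_t(i,j)=\Phi_{ij}$ if $|\Phi_{ij}|\in\mathcal A_t\cup\mathcal N_t$, $\pi_t(i,j)=\mathrm{sign}(\Phi_{ij})$ otherwise. For $t>T$ all quantities are frozen at their time-$T$ values. $\mathcal F_t$ is the $\sigma$-algebra generated by $i_s,j_s$ and $\pi_s(i,j)$ for $s\leq t$ and all $(i,j)$. For $t\geq1$, $K_t^*(i,j)=1$ if $\pi_{t-1}(i,j)=1$ and $\Phi_{ij}\in\mathcal A_t$, and $K_t^*(i,j)=0$ otherwise. An empty product equals $1$. -}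

module Defs where

open import Data.Nat as ℕ using (ℕ; zero; suc; _+_; _*_; _∸_; _^_; _≤ᵇ_; _<ᵇ_)
open import Data.Bool as B using (Bool; true; false; if_then_else_; _∧_; _∨_; not)
open import Data.Fin as F using (Fin; zero; suc)
open import Data.Product using (Σ; _×_; _,_; proj₁; proj₂)
open import Data.Maybe using (Maybe; just; nothing)
open import Data.List as L using (List; []; _∷_; map; concatMap; cartesianProduct; allFin; upTo; foldl; foldr; take)
open import Data.Vec as V using (Vec; toList)
open import Data.Integer as ℤ using (+_)
open import Data.Rational as ℚ using (ℚ; 0ℚ; 1ℚ; _÷_; ≢-nonZero)
open import Data.Rational.Properties as ℚP using ()
open import Relation.Nullary using (does; yes; no)

firstFin : ∀ n → (Fin n → Bool) → Maybe (Fin n)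
firstFin zero    p = nothing
firstFin (suc n) p with p zero
... | true  = just zero
... | false with firstFin n (λ i → p (suc i))
...   | just i  = just (suc i)
...   | nothing = nothing

anyFin : ∀ n → (Fin n → Bool) → Bool
anyFin zero    p = false
anyFin (suc n) p = p zero ∨ anyFin n (λ i → p (suc i))

allFin? : ∀ n → (Fin n → Bool) → Bool
allFin? zero    p = true
allFin? (suc n) p = p zero ∧ allFin? n (λ i → p (suc i))

countFin : ∀ n → (Fin n → Bool) → ℕ
countFin zero    p = 0
countFin (suc n) p = (if p zero then 1 else 0) + countFin n (λ i → p (suc i))

_==F_ : ∀ {n} → Fin n → Fin n → Bool
i ==F j = does (i F.≟ j)

_==B_ : Bool → Bool → Bool
a ==B b = does (a B.≟ b)

allFuns : ∀ {A : Set} (n : ℕ) → List A → List (Fin n → A)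
allFuns zero    xs = (λ ()) ∷ []
allFuns (suc n) xs =
  concatMap (λ a → map (λ f → λ { zero → a ; (suc i) → f i }) (allFuns n xs)) xs

allVecs : ∀ {A : Set} (n : ℕ) → List A → List (Vec A n)
allVecs zero    xs = V.[] ∷ []
allVecs (suc n) xs = concatMap (λ a → map (a V.∷_) (allVecs n xs)) xs

sumℚ : List ℚ → ℚ
sumℚ = foldr ℚ._+_ 0ℚ

-- 1/d for d ≠ 0 (and 0 for d = 0; only ever used with d ≥ 1)
recipℕ : ℕ → ℚ
recipℕ zero    = 0ℚ
recipℕ (suc d) = + 1 ℚ./ suc d

-- a literal over x_1..x_n : (variable |l|, sign(l) = +1 ?)  (true = positive literal)
Lit : ℕ → Set
Lit n = Fin n × Bool

var : ∀ {n} → Lit n → Fin n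
var = proj₁

positive : ∀ {n} → Lit n → Bool
positive = proj₂

allLits : ∀ n → List (Lit n)
allLits n = cartesianProduct (allFin n) (true ∷ false ∷ [])

-- Φ i j = Φ_{ij}: m clauses with k literals each, over n variables
Formula : ℕ → ℕ → ℕ → Set
Formula k m n = Fin m → Fin k → Lit n

allFormulas : ∀ k m n → List (Formula k m n)
allFormulas k m n = allFuns m (allFuns k (allLits n))

VSet : ℕ → Set
VSet n = Fin n → Bool

Assignment : ℕ → Set
Assignment n = Fin n → Bool

_∪ₛ_ : ∀ {n} → VSet n → VSet n → VSet n
(S ∪ₛ T) x = S x ∨ T x

_∖ₛ_ : ∀ {n} → VSet n → VSet n → VSet n
(S ∖ₛ T) x = S x ∧ not (T x)

⁅_⁆ₛ : ∀ {n} → Fin n → VSet n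
⁅ y ⁆ₛ x = x ==F y

∣_∣ₛ : ∀ {n} → VSet n → ℕ
∣_∣ₛ {n} S = countFin n S

litTrue : ∀ {n} → Assignment n → Lit n → Bool
litTrue σ l = σ (var l) ==B positive l

record State (k m n : ℕ) : Set where
  constructor st
  field
    σ    : Assignment n
    A    : VSet n
    N    : VSet n
    Z    : Fin m → Bool
    -- (i_t , j_t); frozen at (i_T , j_T) after stopping; nothing if no step was made
    last : Maybe (Fin m × Fin k)
open State public


data PiVal (n : ℕ) : Set where
  revealed : Lit n → PiVal n    -- π(i,j) = Φ_{ij}
  sgn      : Bool  → PiVal n    -- π(i,j) = sign(Φ_{ij})  (true = +1)


module _ {k m n : ℕ} (Φ : Formula k m n) where

  clauseSat : Assignment n → Fin m → Bool
  clauseSat σ i = anyFin k (λ j → litTrue σ (Φ i j))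

  satisfies : Assignment n → Bool
  satisfies σ = allFin? m (clauseSat σ)

  numUnsat : Assignment n → ℕ
  numUnsat σ = countFin m (λ i → not (clauseSat σ i))

  negativeIn : VSet n → Fin m → Bool
  negativeIn S i = allFin? k (λ j → if positive (Φ i j) then S (var (Φ i j)) else true)

  state₀ : State k m n
  state₀ = st (λ _ → true) (λ _ → false) (λ _ → false) (λ _ → false) nothing

  -- (PI2): condition for clause i to be added, given A_{t-1}, y_t and current Z_t, N_t
  -- "at least k₁ = 0.49k indices" : 100·c ≥ 49·k ;  "more than λ = √k indices" : c·c > k
  pi2Cond : VSet n → Fin n → (Fin m → Bool) → VSet n → Fin m → Bool
  pi2Cond Aold y Zc Nc i =
    not (Zc i) ∧ negativeIn ((Aold ∪ₛ Nc) ∪ₛ ⁅ y ⁆ₛ) i ∧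
    ( (49 * k ≤ᵇ 100 * countFin k (λ j → (Aold ∪ₛ ⁅ y ⁆ₛ) (var (Φ i j))))
    ∨ (k <ᵇ (countFin k (λ j → Nc (var (Φ i j))) * countFin k (λ j → Nc (var (Φ i j))))) )

  pi2Step : VSet n → Fin n → (Fin m → Bool) × VSet n → (Fin m → Bool) × VSet n
  pi2Step Aold y (Zc , Nc) with firstFin m (pi2Cond Aold y Zc Nc)
  ... | nothing = (Zc , Nc)
  ... | just i  = ((λ i' → Zc i' ∨ (i' ==F i)) ,
                   (λ x → Nc x ∨ anyFin k (λ j → var (Φ i j) ==F x)))

  -- the loop adds at most m clauses, so m iterations reach its final state
  iter : ∀ {X : Set} → ℕ → (X → X) → X → X
  iter zero    f x = x
  iter (suc r) f x = iter r f (f x)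

  pi2 : VSet n → Fin n → (Fin m → Bool) × VSet n → (Fin m → Bool) × VSet n
  pi2 Aold y = iter m (pi2Step Aold y)

  step : State k m n → Fin m × Fin k → State k m n
  step s (i , j) with satisfies (σ s)
  ... | true  = s
  ... | false =
    let y  = var (Φ i j)
        ZN = pi2 (A s) y (Z s , N s)
    in st (λ x → if x ==F y then not (σ s x) else σ s x)
          ((A s ∪ₛ ⁅ y ⁆ₛ) ∖ₛ proj₂ ZN)
          (proj₂ ZN)
          (proj₁ ZN)
          (just (i , j))

  -- probability of choosing c at the next step:
  -- 1/(#unsat · k) for an unsatisfied clause, 0 for a satisfied clause.
  -- After stopping the choice is an unobserved dummy, uniform on [m]×[k].
  stepProb : State k m n → Fin m × Fin k → ℚ
  stepProb s (i , j) with satisfies (σ s)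
  ... | true  = recipℕ (m * k)
  ... | false = if clauseSat (σ s) i then 0ℚ else recipℕ (numUnsat (σ s) * k)

  stateAfter : List (Fin m × Fin k) → State k m n
  stateAfter cs = foldl step state₀ cs

  choicesProb : State k m n → List (Fin m × Fin k) → ℚ
  choicesProb s []       = 1ℚ
  choicesProb s (c ∷ cs) = stepProb s c ℚ.* choicesProb (step s c) cs

  piOf : State k m n → Fin m → Fin k → PiVal n
  piOf s i j = if (A s ∪ₛ N s) (var (Φ i j)) then revealed (Φ i j) else sgn (positive (Φ i j))

piEq : ∀ {n} → PiVal n → PiVal n → Bool
piEq (revealed l) (revealed l') = (var l ==F var l') ∧ (positive l ==B positive l')
piEq (sgn b)      (sgn b')      = b ==B b'
piEq _            _             = false

idxEq : ∀ {m k} → Maybe (Fin m × Fin k) → Maybe (Fin m × Fin k) → Bool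
idxEq nothing        nothing          = true
idxEq (just (i , j)) (just (i' , j')) = (i ==F i') ∧ (j ==F j')
idxEq _              _                = false

powℚ : ℚ → ℕ → ℚ
powℚ q zero    = 1ℚ
powℚ q (suc e) = q ℚ.* powℚ q e

prodℚ : List ℚ → ℚ
prodℚ = foldr ℚ._*_ 1ℚ

-- the probability space for steps 1..t :  ω = (Φ , ((i_1,j_1),...,(i_t,j_t)))
-- (the km literals of Φ are i.i.d. uniform over the 2n literals; the choices
--  are made as in (PI1))

Outcome : ℕ → ℕ → ℕ → ℕ → Set
Outcome k m n t = Formula k m n × Vec (Fin m × Fin k) t

allOutcomes : ∀ k m n t → List (Outcome k m n t)
allOutcomes k m n t =
  cartesianProduct (allFormulas k m n) (allVecs t (cartesianProduct (allFin m) (allFin k)))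

formulaOf : ∀ {k m n t} → Outcome k m n t → Formula k m n
formulaOf = proj₁

stateAt : ∀ {k m n t} → Outcome k m n t → ℕ → State k m n
stateAt (Φ , cs) s = stateAfter Φ (take s (toList cs))

prob : ∀ {k m n t} → Outcome k m n t → ℚ
prob {k} {m} {n} (Φ , cs) = powℚ (recipℕ (2 * n)) (k * m) ℚ.* choicesProb Φ (state₀ Φ) (toList cs)

-- ω and ω' are indistinguishable by F_r  (generated by i_s, j_s, π_s(i,j), s ≤ r)
sameInfo : ∀ {k m n t} → ℕ → Outcome k m n t → Outcome k m n t → Bool
sameInfo {k} {m} r ω ω' =
  L.foldr _∧_ true (map (λ s →
      allFin? m (λ i → allFin? k (λ j →
         piEq (piOf (formulaOf ω) (stateAt ω s) i j) (piOf (formulaOf ω') (stateAt ω' s) i j)))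
      ∧ idxEq (last (stateAt ω s)) (last (stateAt ω' s)))
    (upTo (suc r)))

condExp : ∀ k m n t → ℕ → (Outcome k m n t → ℚ) → Outcome k m n t → ℚ
condExp k m n t r X ω with sumℚ (map (λ ω' → if sameInfo r ω ω' then prob ω' else 0ℚ) (allOutcomes k m n t)) ℚ.≟ 0ℚ
... | yes _  = 0ℚ
... | no d≢0 = (sumℚ (map (λ ω' → if sameInfo r ω ω' then prob ω' ℚ.* X ω' else 0ℚ) (allOutcomes k m n t))
                ÷ sumℚ (map (λ ω' → if sameInfo r ω ω' then prob ω' else 0ℚ) (allOutcomes k m n t)))
                {{≢-nonZero d≢0}}

Kstar : ∀ {k m n t} → ℕ → Outcome k m n t → Fin m → Fin k → ℚ
Kstar t' ω i j =
  if piEq (piOf (formulaOf ω) (stateAt ω (t' ∸ 1)) i j) (sgn true)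
     ∧ positive (formulaOf ω i j) ∧ A (stateAt ω t') (var (formulaOf ω i j))
  then 1ℚ else 0ℚ

prodKstar : ∀ {k m n t} → (Fin m → Fin k → Bool) → Outcome k m n t → ℚ
prodKstar {k} {m} {t = t} I ω =
  prodℚ (map (λ ij → if I (proj₁ ij) (proj₂ ij) then Kstar t ω (proj₁ ij) (proj₂ ij) else 1ℚ)
             (cartesianProduct (allFin m) (allFin k)))

sumFin : ∀ n → (Fin n → ℕ) → ℕ
sumFin zero    f = 0
sumFin (suc n) f = f zero + sumFin n (λ i → f (suc i))

∣_∣ᵢ : ∀ {m k} → (Fin m → Fin k → Bool) → ℕ
∣_∣ᵢ {m} {k} I = sumFin m (λ i → countFin k (I i))

bound : ∀ {k m n t} → ℕ → (Fin m → Fin k → Bool) → Outcome k m n t → ℚ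
bound t' I ω =
  recipℕ (ℕ._⊔_ 1 ∣ (λ _ → true) ∖ₛ (A (stateAt ω (t' ∸ 1)) ∪ₛ N (stateAt ω (t' ∸ 1))) ∣ₛ ^ ∣ I ∣ᵢ)

-- Condition on the atom of F_{t-1} containing ω₀.  All outcomes in it share the explored set
-- R = A_{t-1} ∪ N_{t-1}; let U be the number of variables outside R.  If K*_t(i,j) = 1 then at
-- time t-1 position (i,j) was unexplored and positive, the process was running, and the variable
-- at (i,j) was the one flipped at step t.  Renaming the variable at such a position, by a
-- transposition of two unexplored variables, is a measure-preserving bijection of outcomes which
-- changes nothing observable up to time t-1: the literal stays positive and true, so the run is
-- the same.  Hence all U unexplored variables are equally likely to sit at (i,j) while only one of
-- them is flipped, so requiring one more hit costs a factor U, and induction over I* gives the bound.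

module Submission where

open import Defs
open import Data.Nat using (ℕ; _≤_; _*_; _^_)
open import Data.Integer using (+_)
open import Data.Rational using (ℚ; 0ℚ; _<_; _/_; ceiling)
open import Data.Fin using (Fin)
open import Data.Bool using (Bool)
open import Data.Product using (∃-syntax)
open import Relation.Binary.PropositionalEquality using (_≡_)
open import Data.Rational as Q using ()

open import Data.Nat as ℕ using (zero; suc)
import Data.Nat.Properties as ℕP
import Data.Nat.Coprimality as Coprime
import Data.Integer as ℤ
import Data.Integer.Properties as ℤP
open import Data.Rational using (1ℚ)
import Data.Rational.Properties as QP
open import Data.Rational.Solver using (module +-*-Solver)
open import Data.Bool using (true; false; if_then_else_; _∧_; _∨_; not)
import Data.Bool.ListAction as BL
import Data.Bool.Properties as BP
open import Data.Fin as F using (zero; suc)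
import Data.Fin.Permutation as Perm
import Data.Fin.Permutation.Components as PC
open import Data.Product using (_×_; _,_; proj₁; proj₂)
import Data.Product.Properties as ×P
open import Data.Sum using (_⊎_; inj₁; inj₂)
open import Data.Maybe using (just; nothing)
open import Data.List as L
  using (List; []; _∷_; map; concatMap; cartesianProduct; allFin; tabulate; filter; foldr; take; applyUpTo; _++_)
import Data.List.Properties as LP
open import Data.List.Relation.Unary.All as All using (All; []; _∷_)
open import Data.List.Relation.Unary.AllPairs using ([]; _∷_)
open import Data.List.Relation.Unary.Unique.Propositional using (Unique)
import Data.List.Relation.Unary.Unique.Propositional.Properties as Unique
open import Data.Vec as V using (Vec; toList)
import Data.Vec.Functional as VF
open import Data.Vec.Functional using (updateAt)
import Data.Vec.Functional.Properties as VFP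
import Data.Vec.Properties as VP
open import Data.Empty using (⊥-elim)
open import Function using (_∘_; id)
open import Relation.Binary.PropositionalEquality
open import Relation.Nullary using (yes; no)
open import Relation.Nullary.Decidable using (T?)
import Algebra.Properties.CommutativeMonoid.Sum as CommutativeMonoidSum
import Algebra.Properties.Semiring.Sum as SemiringSum
open import Algebra.Bundles using (Ring)

open +-*-Solver using (solve; _:+_; _:*_; _:=_; con)
open CommutativeMonoidSum QP.+-0-commutativeMonoid using (sum; sum-cong-≗; sum-replicate-zero; ∑-permute; ∑-distrib-+)
open SemiringSum (Ring.semiring QP.+-*-ring) using (*-distribˡ-sum)

true≢false : true ≢ false
true≢false ()

∧-trueˡ : ∀ {a b} → (a ∧ b) ≡ true → a ≡ true
∧-trueˡ {true} _ = refl

∧-trueʳ : ∀ {a b} → (a ∧ b) ≡ true → b ≡ true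
∧-trueʳ {true} h = h

∧-true : ∀ {a b} → a ≡ true → b ≡ true → (a ∧ b) ≡ true
∧-true refl refl = refl

∨-trueˡ : ∀ {a} b → a ≡ true → (a ∨ b) ≡ true
∨-trueˡ b refl = refl

∨-trueʳ : ∀ a {b} → b ≡ true → (a ∨ b) ≡ true
∨-trueʳ true refl = refl
∨-trueʳ false refl = refl

∨-true⇒ : ∀ {a b} → (a ∨ b) ≡ true → a ≡ true ⊎ b ≡ true
∨-true⇒ {true} _ = inj₁ refl
∨-true⇒ {false} h = inj₂ h

not-true⇒ : ∀ {b} → not b ≡ true → b ≡ false
not-true⇒ {false} _ = refl

true⇔true⇒≡ : ∀ {a b} → (a ≡ true → b ≡ true) → (b ≡ true → a ≡ true) → a ≡ b
true⇔true⇒≡ {true} {true} _ _ = refl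
true⇔true⇒≡ {true} {false} f _ = sym (f refl)
true⇔true⇒≡ {false} {true} _ g = g refl
true⇔true⇒≡ {false} {false} _ _ = refl

==F-refl : ∀ {n} (x : Fin n) → (x ==F x) ≡ true
==F-refl x with x F.≟ x
... | yes _ = refl
... | no x≢x = ⊥-elim (x≢x refl)

==F⇒≡ : ∀ {n} {x y : Fin n} → (x ==F y) ≡ true → x ≡ y
==F⇒≡ {x = x} {y} h with x F.≟ y
... | yes x≡y = x≡y

≢⇒==F-false : ∀ {n} {x y : Fin n} → x ≢ y → (x ==F y) ≡ false
≢⇒==F-false {x = x} {y} x≢y with x F.≟ y
... | yes x≡y = ⊥-elim (x≢y x≡y)
... | no _ = refl

==F-sym : ∀ {n} (x y : Fin n) → (x ==F y) ≡ (y ==F x)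
==F-sym x y = true⇔true⇒≡ (λ h → subst (λ z → (z ==F x) ≡ true) (==F⇒≡ {x = x} h) (==F-refl x))
                          (λ h → subst (λ z → (z ==F y) ≡ true) (==F⇒≡ {x = y} h) (==F-refl y))

==F-suc : ∀ {n} (x y : Fin n) → (suc x ==F suc y) ≡ (x ==F y)
==F-suc x y with x F.≟ y
... | yes refl = refl
... | no _ = refl

allFin?-cong : ∀ n {p q : Fin n → Bool} → (∀ i → p i ≡ q i) → allFin? n p ≡ allFin? n q
allFin?-cong zero h = refl
allFin?-cong (suc n) h = cong₂ _∧_ (h zero) (allFin?-cong n (h ∘ suc))

anyFin-cong : ∀ n {p q : Fin n → Bool} → (∀ i → p i ≡ q i) → anyFin n p ≡ anyFin n q
anyFin-cong zero h = refl
anyFin-cong (suc n) h = cong₂ _∨_ (h zero) (anyFin-cong n (h ∘ suc))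

countFin-cong : ∀ n {p q : Fin n → Bool} → (∀ i → p i ≡ q i) → countFin n p ≡ countFin n q
countFin-cong zero h = refl
countFin-cong (suc n) {q = q} h rewrite h zero =
  cong ((if q zero then 1 else 0) ℕ.+_) (countFin-cong n (h ∘ suc))

firstFin-cong : ∀ n {p q : Fin n → Bool} → (∀ i → p i ≡ q i) → firstFin n p ≡ firstFin n q
firstFin-cong zero h = refl
firstFin-cong (suc n) {p} {q} h with p zero | q zero | h zero
... | true | .true | refl = refl
... | false | .false | refl with firstFin n (p ∘ suc) | firstFin n (q ∘ suc) | firstFin-cong n (h ∘ suc)
...   | just i | .(just i) | refl = refl
...   | nothing | .nothing | refl = refl

allFin?⇒ : ∀ n {p : Fin n → Bool} → allFin? n p ≡ true → ∀ i → p i ≡ true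
allFin?⇒ (suc n) h zero = ∧-trueˡ h
allFin?⇒ (suc n) {p} h (suc i) = allFin?⇒ n (∧-trueʳ {p zero} h) i

anyFin-intro : ∀ n {p : Fin n → Bool} (i : Fin n) → p i ≡ true → anyFin n p ≡ true
anyFin-intro (suc n) zero h = ∨-trueˡ _ h
anyFin-intro (suc n) {p} (suc i) h = ∨-trueʳ (p zero) (anyFin-intro n i h)

anyFin⇒ : ∀ n {p : Fin n → Bool} → anyFin n p ≡ true → ∃[ i ] p i ≡ true
anyFin⇒ (suc n) {p} h with ∨-true⇒ {p zero} h
... | inj₁ h₀ = zero , h₀
... | inj₂ hs with anyFin⇒ n hs
...   | i , e = suc i , e

sumOver : ∀ {X : Set} → List X → (X → ℚ) → ℚ
sumOver xs f = sumℚ (map f xs)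

when : Bool → ℚ → ℚ
when b q = if b then q else 0ℚ

when-0 : ∀ b → when b 0ℚ ≡ 0ℚ
when-0 true = refl
when-0 false = refl

0≤1 : 0ℚ Q.≤ 1ℚ
0≤1 = Q.*≤* (ℤ.+≤+ ℕ.z≤n)

0≤-+ : ∀ {p q} → 0ℚ Q.≤ p → 0ℚ Q.≤ q → 0ℚ Q.≤ p Q.+ q
0≤-+ = QP.+-mono-≤

0≤-* : ∀ {p q} → 0ℚ Q.≤ p → 0ℚ Q.≤ q → 0ℚ Q.≤ p Q.* q
0≤-* {p} 0≤p 0≤q = QP.≤-trans (QP.≤-reflexive (sym (QP.*-zeroʳ p)))
                              (QP.*-monoˡ-≤-nonNeg p {{Q.nonNegative 0≤p}} 0≤q)

0≤-when : ∀ b {q} → 0ℚ Q.≤ q → 0ℚ Q.≤ when b q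
0≤-when true h = h
0≤-when false h = QP.≤-refl

when-mono : ∀ b {p q} → p Q.≤ q → when b p Q.≤ when b q
when-mono true h = h
when-mono false h = QP.≤-refl

when-≤ : ∀ b {q} → 0ℚ Q.≤ q → when b q Q.≤ q
when-≤ true h = QP.≤-refl
when-≤ false h = h

when-⇒ : ∀ {a b q} → (a ≡ true → b ≡ true) → 0ℚ Q.≤ q → when a q Q.≤ when b q
when-⇒ {true} h 0≤q rewrite h refl = QP.≤-refl
when-⇒ {false} {b} h 0≤q = 0≤-when b 0≤q

sumOver-cong : ∀ {X : Set} (xs : List X) {f g : X → ℚ} → (∀ x → f x ≡ g x) → sumOver xs f ≡ sumOver xs g
sumOver-cong [] h = refl
sumOver-cong (x ∷ xs) h = cong₂ Q._+_ (h x) (sumOver-cong xs h)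

sumOver-mono : ∀ {X : Set} (xs : List X) {f g : X → ℚ} → (∀ x → f x Q.≤ g x) → sumOver xs f Q.≤ sumOver xs g
sumOver-mono [] h = QP.≤-refl
sumOver-mono (x ∷ xs) h = QP.+-mono-≤ (h x) (sumOver-mono xs h)

0≤-sumOver : ∀ {X : Set} (xs : List X) {f : X → ℚ} → (∀ x → 0ℚ Q.≤ f x) → 0ℚ Q.≤ sumOver xs f
0≤-sumOver [] h = QP.≤-refl
0≤-sumOver (x ∷ xs) h = 0≤-+ (h x) (0≤-sumOver xs h)

sumOver-zero : ∀ {X : Set} (xs : List X) → sumOver xs (λ _ → 0ℚ) ≡ 0ℚ
sumOver-zero [] = refl
sumOver-zero (x ∷ xs) = cong (0ℚ Q.+_) (sumOver-zero xs)

sumOver-++ : ∀ {X : Set} (xs ys : List X) (f : X → ℚ) → sumOver (xs ++ ys) f ≡ sumOver xs f Q.+ sumOver ys f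
sumOver-++ [] ys f = sym (QP.+-identityˡ _)
sumOver-++ (x ∷ xs) ys f = trans (cong (f x Q.+_) (sumOver-++ xs ys f)) (sym (QP.+-assoc (f x) _ _))

sumOver-map : ∀ {X Y : Set} (xs : List X) (g : X → Y) (f : Y → ℚ) → sumOver (map g xs) f ≡ sumOver xs (f ∘ g)
sumOver-map [] g f = refl
sumOver-map (x ∷ xs) g f = cong (f (g x) Q.+_) (sumOver-map xs g f)

sumOver-concatMap : ∀ {X Y : Set} (xs : List X) (h : X → List Y) (f : Y → ℚ) →
  sumOver (concatMap h xs) f ≡ sumOver xs (λ x → sumOver (h x) f)
sumOver-concatMap [] h f = refl
sumOver-concatMap (x ∷ xs) h f =
  trans (sumOver-++ (h x) (concatMap h xs) f) (cong (sumOver (h x) f Q.+_) (sumOver-concatMap xs h f))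

sumOver-cartesianProduct : ∀ {X Y : Set} (xs : List X) (ys : List Y) (f : X × Y → ℚ) →
  sumOver (cartesianProduct xs ys) f ≡ sumOver xs (λ x → sumOver ys (λ y → f (x , y)))
sumOver-cartesianProduct [] ys f = refl
sumOver-cartesianProduct (x ∷ xs) ys f =
  trans (sumOver-++ (map (x ,_) ys) (cartesianProduct xs ys) f)
        (cong₂ Q._+_ (sumOver-map ys (x ,_) f) (sumOver-cartesianProduct xs ys f))

sumOver-allFin : ∀ n (f : Fin n → ℚ) → sumOver (allFin n) f ≡ sum f
sumOver-allFin n f = go n id
  where
  go : ∀ n (g : Fin n → Fin _) → sumOver (tabulate g) f ≡ sum (f ∘ g)
  go zero g = refl
  go (suc n) g = cong (f (g zero) Q.+_) (go n (g ∘ suc))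

sum-mono : ∀ n {f g : Fin n → ℚ} → (∀ x → f x Q.≤ g x) → sum f Q.≤ sum g
sum-mono zero h = QP.≤-refl
sum-mono (suc n) h = QP.+-mono-≤ (h zero) (sum-mono n (h ∘ suc))

0≤-sum : ∀ n {f : Fin n → ℚ} → (∀ x → 0ℚ Q.≤ f x) → 0ℚ Q.≤ sum f
0≤-sum zero h = QP.≤-refl
0≤-sum (suc n) h = 0≤-+ (h zero) (0≤-sum n (h ∘ suc))

term≤sum : ∀ n {f : Fin n → ℚ} → (∀ x → 0ℚ Q.≤ f x) → ∀ a → f a Q.≤ sum f
term≤sum (suc n) {f} h zero =
  QP.≤-trans (QP.≤-reflexive (sym (QP.+-identityʳ (f zero)))) (QP.+-monoʳ-≤ (f zero) (0≤-sum n (h ∘ suc)))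
term≤sum (suc n) {f} h (suc a) =
  QP.≤-trans (term≤sum n (h ∘ suc) a)
    (QP.≤-trans (QP.≤-reflexive (sym (QP.+-identityˡ _))) (QP.+-monoˡ-≤ (sum (f ∘ suc)) (h zero)))

sum-sumOver-comm : ∀ n {X : Set} (xs : List X) (f : Fin n → X → ℚ) →
  sum (λ a → sumOver xs (f a)) ≡ sumOver xs (λ x → sum (λ a → f a x))
sum-sumOver-comm n [] f = sum-replicate-zero n
sum-sumOver-comm n (x ∷ xs) f =
  trans (∑-distrib-+ (λ a → f a x) (λ a → sumOver xs (f a)))
        (cong (sum (λ a → f a x) Q.+_) (sum-sumOver-comm n xs f))

sum-when-==F : ∀ n (x : Fin n) (q : ℚ) → sum (λ y → when (x ==F y) q) ≡ q
sum-when-==F (suc n) zero q rewrite ==F-refl (zero {n}) =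
  trans (cong (q Q.+_) (trans (sum-cong-≗ {n} (λ y → cong (λ b → when b q) (≢⇒==F-false {x = zero} {suc y} λ ())))
                               (sum-replicate-zero n)))
        (QP.+-identityʳ q)
sum-when-==F (suc n) (suc x) q =
  trans (cong₂ Q._+_ (cong (λ b → when b q) (≢⇒==F-false {x = suc x} {zero} λ ()))
                     (trans (sum-cong-≗ {n} (λ y → cong (λ b → when b q) (==F-suc x y))) (sum-when-==F n x q)))
        (QP.+-identityˡ q)

natℚ : ℕ → ℚ
natℚ zero = 0ℚ
natℚ (suc c) = 1ℚ Q.+ natℚ c

0≤-natℚ : ∀ c → 0ℚ Q.≤ natℚ c
0≤-natℚ zero = QP.≤-refl
0≤-natℚ (suc c) = 0≤-+ 0≤1 (0≤-natℚ c)

natℚ-+ : ∀ a b → natℚ (a ℕ.+ b) ≡ natℚ a Q.+ natℚ b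
natℚ-+ zero b = sym (QP.+-identityˡ (natℚ b))
natℚ-+ (suc a) b = trans (cong (1ℚ Q.+_) (natℚ-+ a b)) (sym (QP.+-assoc 1ℚ (natℚ a) (natℚ b)))

natℚ-* : ∀ a b → natℚ (a ℕ.* b) ≡ natℚ a Q.* natℚ b
natℚ-* zero b = sym (QP.*-zeroˡ (natℚ b))
natℚ-* (suc a) b = trans (natℚ-+ b (a ℕ.* b)) (trans (cong (natℚ b Q.+_) (natℚ-* a b))
  (solve 2 (λ x y → y :+ (x :* y) := (con 1ℚ :+ x) :* y) refl (natℚ a) (natℚ b)))

natℚ-1-* : ∀ q → natℚ 1 Q.* q ≡ q
natℚ-1-* q = solve 1 (λ x → (con 1ℚ :+ con 0ℚ) :* x := x) refl q

sum-when-count : ∀ n (u : Fin n → Bool) (q : ℚ) → sum (λ a → when (u a) q) ≡ natℚ (countFin n u) Q.* q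
sum-when-count zero u q = sym (QP.*-zeroˡ q)
sum-when-count (suc n) u q with u zero
... | true = trans (cong (q Q.+_) (sum-when-count n (u ∘ suc) q))
                   (solve 2 (λ q x → q :+ (x :* q) := (con 1ℚ :+ x) :* q) refl q (natℚ (countFin n (u ∘ suc))))
... | false = trans (QP.+-identityˡ _) (sum-when-count n (u ∘ suc) q)

0≤-recipℕ : ∀ d → 0ℚ Q.≤ recipℕ d
0≤-recipℕ zero = QP.≤-refl
0≤-recipℕ (suc d) = QP.nonNegative⁻¹ _ {{QP.normalize-nonNeg 1 (suc d)}}

natℚ≡mkℚ : ∀ c → natℚ c ≡ Q.mkℚ (+ c) 0 (Coprime.sym (Coprime.1-coprimeTo c))
natℚ≡mkℚ zero = refl
natℚ≡mkℚ (suc c) rewrite natℚ≡mkℚ c =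
  trans (cong (λ z → (+ 1 ℤ.+ z) Q./ 1) (trans (ℤP.+◃n≡+n (c ℕ.* 1)) (cong +_ (ℕP.*-identityʳ c))))
        (QP.↥p/↧p≡p (Q.mkℚ (+ suc c) 0 _))

recipℕ-*-natℚ : ∀ d → recipℕ (suc d) Q.* natℚ (suc d) ≡ 1ℚ
recipℕ-*-natℚ d rewrite natℚ≡mkℚ (suc d) | QP.↥p/↧p≡p (Q.mkℚ (+ 1) d (Coprime.1-coprimeTo (suc d))) =
  QP.*-inverseˡ (Q.mkℚ (+ suc d) 0 (Coprime.sym (Coprime.1-coprimeTo (suc d))))

÷≤recipℕ : ∀ (p q : ℚ) c → 0 ℕ.< c → 0ℚ Q.≤ p → 0ℚ Q.≤ q → (q≢0 : q ≢ 0ℚ) →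
  natℚ c Q.* p Q.≤ q → (p Q.÷ q) {{Q.≢-nonZero q≢0}} Q.≤ recipℕ c
÷≤recipℕ p q (suc d) _ 0≤p 0≤q q≢0 cp≤q = begin
  p Q.* 1/q
    ≡⟨ cong (Q._* 1/q) (trans (cong (Q._* p) (recipℕ-*-natℚ d)) (QP.*-identityˡ p)) ⟨
  ((r Q.* natℚ (suc d)) Q.* p) Q.* 1/q
    ≡⟨ cong (Q._* 1/q) (QP.*-assoc r (natℚ (suc d)) p) ⟩
  (r Q.* (natℚ (suc d) Q.* p)) Q.* 1/q
    ≤⟨ QP.*-monoʳ-≤-nonNeg 1/q {{0≤1/q}}
         (QP.*-monoˡ-≤-nonNeg r {{Q.nonNegative (0≤-recipℕ (suc d))}} cp≤q) ⟩
  (r Q.* q) Q.* 1/q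
    ≡⟨ QP.*-assoc r q 1/q ⟩
  r Q.* (q Q.* 1/q)
    ≡⟨ cong (r Q.*_) (QP.*-inverseʳ q) ⟩
  r Q.* 1ℚ
    ≡⟨ QP.*-identityʳ r ⟩
  r ∎
  where
  open QP.≤-Reasoning
  instance
    _ = Q.≢-nonZero q≢0
    _ = Q.nonNegative 0≤q
  r = recipℕ (suc d)
  1/q = (Q.1/ q) {{Q.≢-nonZero q≢0}}
  q>0 : Q.Positive q
  q>0 = QP.nonNeg∧nonZero⇒pos q
  0≤1/q : Q.NonNegative 1/q
  0≤1/q = QP.pos⇒nonNeg 1/q {{QP.1/pos⇒pos q {{q>0}}}}

prodℚ-01 : ∀ {X : Set} (f : X → ℚ) xs → (∀ x → f x ≡ 0ℚ ⊎ f x ≡ 1ℚ) →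
  prodℚ (map f xs) ≡ 0ℚ ⊎ (prodℚ (map f xs) ≡ 1ℚ × All (λ x → f x ≡ 1ℚ) xs)
prodℚ-01 f [] h = inj₂ (refl , [])
prodℚ-01 f (x ∷ xs) h with h x
... | inj₁ fx≡0 = inj₁ (trans (cong (Q._* prodℚ (map f xs)) fx≡0) (QP.*-zeroˡ (prodℚ (map f xs))))
... | inj₂ fx≡1 with prodℚ-01 f xs h
...   | inj₁ ≡0 = inj₁ (trans (cong₂ Q._*_ fx≡1 ≡0) (QP.*-zeroʳ 1ℚ))
...   | inj₂ (≡1 , all≡1) = inj₂ (trans (cong₂ Q._*_ fx≡1 ≡1) (QP.*-identityʳ 1ℚ) , fx≡1 ∷ all≡1)

countL : ∀ {X : Set} → (X → Bool) → List X → ℕ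
countL P [] = 0
countL P (x ∷ xs) = (if P x then 1 else 0) ℕ.+ countL P xs

length-filter : ∀ {X : Set} (P : X → Bool) xs → L.length (filter (T? ∘ P) xs) ≡ countL P xs
length-filter P [] = refl
length-filter P (x ∷ xs) with P x
... | true = cong suc (length-filter P xs)
... | false = length-filter P xs

countL-++ : ∀ {X : Set} (P : X → Bool) xs ys → countL P (xs ++ ys) ≡ countL P xs ℕ.+ countL P ys
countL-++ P [] ys = refl
countL-++ P (x ∷ xs) ys =
  trans (cong ((if P x then 1 else 0) ℕ.+_) (countL-++ P xs ys)) (sym (ℕP.+-assoc (if P x then 1 else 0) _ _))

countL-map : ∀ {X Y : Set} (P : Y → Bool) (f : X → Y) xs → countL P (map f xs) ≡ countL (P ∘ f) xs
countL-map P f [] = refl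
countL-map P f (x ∷ xs) = cong ((if P (f x) then 1 else 0) ℕ.+_) (countL-map P f xs)

countL-tabulate : ∀ {X : Set} (P : X → Bool) N (g : Fin N → X) → countL P (tabulate g) ≡ countFin N (P ∘ g)
countL-tabulate P zero g = refl
countL-tabulate P (suc N) g = cong ((if P (g zero) then 1 else 0) ℕ.+_) (countL-tabulate P N (g ∘ suc))

sumFin-cong : ∀ N {f g : Fin N → ℕ} → (∀ i → f i ≡ g i) → sumFin N f ≡ sumFin N g
sumFin-cong zero h = refl
sumFin-cong (suc N) h = cong₂ ℕ._+_ (h zero) (sumFin-cong N (h ∘ suc))

countL-cartesianProduct : ∀ {X Y : Set} (P : X × Y → Bool) N (g : Fin N → X) (ys : List Y) →
  countL P (cartesianProduct (tabulate g) ys) ≡ sumFin N (λ i → countL (λ y → P (g i , y)) ys)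
countL-cartesianProduct P zero g ys = refl
countL-cartesianProduct P (suc N) g ys =
  trans (countL-++ P (map (g zero ,_) ys) _)
        (cong₂ ℕ._+_ (countL-map P (g zero ,_) ys) (countL-cartesianProduct P N (g ∘ suc) ys))

positions : ∀ m k → List (Fin m × Fin k)
positions m k = cartesianProduct (allFin m) (allFin k)

positionsIn : ∀ {m k} → (Fin m → Fin k → Bool) → List (Fin m × Fin k)
positionsIn {m} {k} I = filter (T? ∘ λ q → I (proj₁ q) (proj₂ q)) (positions m k)

positionsIn-unique : ∀ {m k} (I : Fin m → Fin k → Bool) → Unique (positionsIn I)
positionsIn-unique {m} {k} I =
  Unique.filter⁺ (T? ∘ λ q → I (proj₁ q) (proj₂ q))
                 (Unique.cartesianProduct⁺ (Unique.allFin⁺ m) (Unique.allFin⁺ k))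

length-positionsIn : ∀ {m k} (I : Fin m → Fin k → Bool) → L.length (positionsIn I) ≡ ∣ I ∣ᵢ
length-positionsIn {m} {k} I =
  trans (length-filter (λ q → I (proj₁ q) (proj₂ q)) (positions m k))
        (trans (countL-cartesianProduct (λ q → I (proj₁ q) (proj₂ q)) m id (allFin k))
               (sumFin-cong m (λ i → countL-tabulate (I i) k id)))

-- Symmetry of the uniform measure on formulas

-- The functions enumerated by allFuns are built from pattern-matching lambdas, so without function
-- extensionality the summands are only required to respect pointwise equality _≋_.
module UniformFunctions {A : Set} (_≈_ : A → A → Set) (≈-refl : ∀ {a} → a ≈ a) where

  _≋_ : ∀ {n} → (Fin n → A) → (Fin n → A) → Set
  f ≋ g = ∀ j → f j ≈ g j

  Respects≋ : ∀ {n} → ((Fin n → A) → ℚ) → Set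
  Respects≋ F = ∀ {f g} → f ≋ g → F f ≡ F g

  updateAt-cong≋ : ∀ {n} (i : Fin n) {τ : A → A} → (∀ {a b} → a ≈ b → τ a ≈ τ b) →
    ∀ {f g} → f ≋ g → updateAt f i τ ≋ updateAt g i τ
  updateAt-cong≋ zero τ-cong f≋g zero = τ-cong (f≋g zero)
  updateAt-cong≋ zero τ-cong f≋g (suc j) = f≋g (suc j)
  updateAt-cong≋ (suc i) τ-cong f≋g zero = f≋g zero
  updateAt-cong≋ (suc i) τ-cong f≋g (suc j) = updateAt-cong≋ i τ-cong (f≋g ∘ suc) j

  ∷-cong≋ : ∀ {n} {a b : A} {f g : Fin n → A} → a ≈ b → f ≋ g → (a VF.∷ f) ≋ (b VF.∷ g)
  ∷-cong≋ a≈b f≋g zero = a≈b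
  ∷-cong≋ a≈b f≋g (suc j) = f≋g j

  ≋-refl : ∀ {n} {f : Fin n → A} → f ≋ f
  ≋-refl _ = ≈-refl

  sumOver-allFuns-suc : ∀ n (xs : List A) (F : (Fin (suc n) → A) → ℚ) → Respects≋ F →
    sumOver (allFuns (suc n) xs) F ≡ sumOver xs (λ a → sumOver (allFuns n xs) (λ f → F (a VF.∷ f)))
  sumOver-allFuns-suc n xs F F-resp =
    trans (sumOver-concatMap xs _ F)
          (sumOver-cong xs (λ a → trans (sumOver-map (allFuns n xs) _ F)
             (sumOver-cong (allFuns n xs) (λ f → F-resp λ { zero → ≈-refl ; (suc j) → ≈-refl }))))

  sumOver-allFuns-updateAt : ∀ n (xs : List A) {τ : A → A} → (∀ {a b} → a ≈ b → τ a ≈ τ b) → (i : Fin n) →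
    (∀ (G : A → ℚ) → (∀ {a b} → a ≈ b → G a ≡ G b) → sumOver xs (G ∘ τ) ≡ sumOver xs G) →
    ∀ (F : (Fin n → A) → ℚ) → Respects≋ F →
    sumOver (allFuns n xs) (λ f → F (updateAt f i τ)) ≡ sumOver (allFuns n xs) F
  sumOver-allFuns-updateAt (suc n) xs τ-cong zero τ-invariant F F-resp = begin
    sumOver (allFuns (suc n) xs) (λ f → F (updateAt f zero _))
      ≡⟨ sumOver-allFuns-suc n xs _ (F-resp ∘ updateAt-cong≋ zero τ-cong) ⟩
    sumOver xs (λ a → sumOver (allFuns n xs) (λ f → F (updateAt (a VF.∷ f) zero _)))
      ≡⟨ sumOver-cong xs (λ a → sumOver-cong (allFuns n xs)
                                (λ f → F-resp λ { zero → ≈-refl ; (suc j) → ≈-refl })) ⟩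
    sumOver xs (λ a → sumOver (allFuns n xs) (λ f → F (_ VF.∷ f)))
      ≡⟨ τ-invariant (λ b → sumOver (allFuns n xs) (λ f → F (b VF.∷ f)))
                     (λ a≈b → sumOver-cong (allFuns n xs) (λ f → F-resp (∷-cong≋ a≈b ≋-refl))) ⟩
    sumOver xs (λ a → sumOver (allFuns n xs) (λ f → F (a VF.∷ f)))
      ≡⟨ sumOver-allFuns-suc n xs F F-resp ⟨
    sumOver (allFuns (suc n) xs) F ∎
    where open ≡-Reasoning
  sumOver-allFuns-updateAt (suc n) xs {τ} τ-cong (suc i) τ-invariant F F-resp = begin
    sumOver (allFuns (suc n) xs) (λ f → F (updateAt f (suc i) τ))
      ≡⟨ sumOver-allFuns-suc n xs _ (F-resp ∘ updateAt-cong≋ (suc i) τ-cong) ⟩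
    sumOver xs (λ a → sumOver (allFuns n xs) (λ f → F (updateAt (a VF.∷ f) (suc i) τ)))
      ≡⟨ sumOver-cong xs (λ a → trans
           (sumOver-cong (allFuns n xs) (λ f → F-resp λ { zero → ≈-refl ; (suc j) → ≈-refl }))
           (sumOver-allFuns-updateAt n xs τ-cong i τ-invariant (λ f → F (a VF.∷ f))
                                     (F-resp ∘ ∷-cong≋ ≈-refl))) ⟩
    sumOver xs (λ a → sumOver (allFuns n xs) (λ f → F (a VF.∷ f)))
      ≡⟨ sumOver-allFuns-suc n xs F F-resp ⟨
    sumOver (allFuns (suc n) xs) F ∎
    where open ≡-Reasoning

transposeVar : ∀ {n} → Fin n → Fin n → Lit n → Lit n
transposeVar a b (x , s) = PC.transpose a b x , s

sumOver-allLits-transposeVar : ∀ n (a b : Fin n) (G : Lit n → ℚ) →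
  sumOver (allLits n) (G ∘ transposeVar a b) ≡ sumOver (allLits n) G
sumOver-allLits-transposeVar n a b G = begin
  sumOver (allLits n) (G ∘ transposeVar a b)
    ≡⟨ sumOver-cartesianProduct (allFin n) _ _ ⟩
  sumOver (allFin n) (λ x → signs (PC.transpose a b x))
    ≡⟨ sumOver-allFin n _ ⟩
  sum (λ x → signs (PC.transpose a b x))
    ≡⟨ ∑-permute signs (Perm.transpose a b) ⟨
  sum signs
    ≡⟨ sumOver-allFin n signs ⟨
  sumOver (allFin n) signs
    ≡⟨ sumOver-cartesianProduct (allFin n) _ _ ⟨
  sumOver (allLits n) G ∎
  where
  open ≡-Reasoning
  signs : Fin n → ℚ
  signs x = sumOver (true ∷ false ∷ []) (λ s → G (x , s))

_≗ᶠ_ : ∀ {k m n} → Formula k m n → Formula k m n → Set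
Φ ≗ᶠ Φ' = ∀ i j → Φ i j ≡ Φ' i j

transposeAt : ∀ {k m n} → Fin m → Fin k → Fin n → Fin n → Formula k m n → Formula k m n
transposeAt i j a b Φ = updateAt Φ i (λ clause → updateAt clause j (transposeVar a b))

sumOver-allFormulas-transposeAt : ∀ k m n (i : Fin m) (j : Fin k) (a b : Fin n) (F : Formula k m n → ℚ) →
  (∀ {Φ Φ'} → Φ ≗ᶠ Φ' → F Φ ≡ F Φ') →
  sumOver (allFormulas k m n) (F ∘ transposeAt i j a b) ≡ sumOver (allFormulas k m n) F
sumOver-allFormulas-transposeAt k m n i j a b F F-resp =
  Clauses.sumOver-allFuns-updateAt m (allFuns k (allLits n))
    (Literals.updateAt-cong≋ j (cong (transposeVar a b))) i
    (λ G G-resp → Literals.sumOver-allFuns-updateAt k (allLits n) (cong (transposeVar a b)) j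
                    (λ G' _ → sumOver-allLits-transposeVar n a b G') G G-resp)
    F F-resp
  where
  module Literals = UniformFunctions {Lit n} _≡_ refl
  module Clauses = UniformFunctions {Fin k → Lit n} (λ r r' → ∀ j → r j ≡ r' j) (λ _ → refl)

-- Invariants of a single run

explored : ∀ {k m n} → State k m n → VSet n
explored s = A s ∪ₛ N s

_⊆ₛ_ : ∀ {n} → VSet n → VSet n → Set
S ⊆ₛ T = ∀ x → S x ≡ true → T x ≡ true

⊆ₛ-false : ∀ {n} {S T : VSet n} → S ⊆ₛ T → ∀ x → T x ≡ false → S x ≡ false
⊆ₛ-false {S = S} S⊆T x Tx≡false with S x in Sx
... | false = refl
... | true = ⊥-elim (true≢false (trans (sym (S⊆T x Sx)) Tx≡false))

HiddenTrue : ∀ {k m n} → State k m n → Set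
HiddenTrue s = ∀ x → explored s x ≡ false → σ s x ≡ true

hiddenTrue-outside : ∀ {k m n} (s : State k m n) {R₀ : VSet n} → HiddenTrue s → explored s ⊆ₛ R₀ →
  ∀ x → R₀ x ≡ false → σ s x ≡ true
hiddenTrue-outside s hidden ⊆R₀ x out = hidden x (⊆ₛ-false ⊆R₀ x out)

ExploredOccur : ∀ {k m n} → Formula k m n → State k m n → Set
ExploredOccur Φ s = ∀ x → explored s x ≡ true → ∃[ i ] ∃[ j ] var (Φ i j) ≡ x

module Run {k m n : ℕ} (Φ : Formula k m n) where

  run : State k m n → List (Fin m × Fin k) → State k m n
  run = L.foldl (step Φ)

  advance : State k m n → Fin m × Fin k → State k m n
  advance s (i , j) =
    st (λ x → if x ==F var (Φ i j) then not (σ s x) else σ s x)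
       ((A s ∪ₛ ⁅ var (Φ i j) ⁆ₛ) ∖ₛ proj₂ (pi2 Φ (A s) (var (Φ i j)) (Z s , N s)))
       (proj₂ (pi2 Φ (A s) (var (Φ i j)) (Z s , N s)))
       (proj₁ (pi2 Φ (A s) (var (Φ i j)) (Z s , N s)))
       (just (i , j))

  step-running : ∀ s c → satisfies Φ (σ s) ≡ false → step Φ s c ≡ advance s c
  step-running s (i , j) h rewrite h = refl

  step-stopped : ∀ s c → satisfies Φ (σ s) ≡ true → step Φ s c ≡ s
  step-stopped s (i , j) h rewrite h = refl

  pi2Step-⊇ : ∀ Aold y (p : (Fin m → Bool) × VSet n) → proj₂ p ⊆ₛ proj₂ (pi2Step Φ Aold y p)
  pi2Step-⊇ Aold y (Zc , Nc) x h with firstFin m (pi2Cond Φ Aold y Zc Nc)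
  ... | nothing = h
  ... | just i = ∨-trueˡ _ h

  pi2Step-just : ∀ Aold y Zc Nc i → firstFin m (pi2Cond Φ Aold y Zc Nc) ≡ just i →
    pi2Step Φ Aold y (Zc , Nc) ≡
      ((λ i' → Zc i' ∨ (i' ==F i)) , (λ x → Nc x ∨ anyFin k (λ j → var (Φ i j) ==F x)))
  pi2Step-just Aold y Zc Nc i h rewrite h = refl

  iter-pi2Step-⊇ : ∀ r Aold y (p : (Fin m → Bool) × VSet n) → proj₂ p ⊆ₛ proj₂ (iter Φ r (pi2Step Φ Aold y) p)
  iter-pi2Step-⊇ zero Aold y p x h = h
  iter-pi2Step-⊇ (suc r) Aold y p x h = iter-pi2Step-⊇ r Aold y (pi2Step Φ Aold y p) x (pi2Step-⊇ Aold y p x h)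

  explored-advance : ∀ s i j x →
    explored (advance s (i , j)) x ≡
      ((A s x ∨ (x ==F var (Φ i j))) ∨ proj₂ (pi2 Φ (A s) (var (Φ i j)) (Z s , N s)) x)
  explored-advance s i j x with proj₂ (pi2 Φ (A s) (var (Φ i j)) (Z s , N s)) x
  ... | true = trans (BP.∨-zeroʳ _) (sym (BP.∨-zeroʳ _))
  ... | false = trans (BP.∨-identityʳ _) (trans (BP.∧-identityʳ _) (sym (BP.∨-identityʳ _)))

  step-explored-⊇ : ∀ s c → explored s ⊆ₛ explored (step Φ s c)
  step-explored-⊇ s (i , j) x h with satisfies Φ (σ s)
  ... | true = h
  ... | false rewrite explored-advance s i j x with ∨-true⇒ {A s x} h
  ...   | inj₁ a = ∨-trueˡ _ (∨-trueˡ _ a)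
  ...   | inj₂ b = ∨-trueʳ _ (iter-pi2Step-⊇ m (A s) (var (Φ i j)) (Z s , N s) x b)

  advance-explores-flipped : ∀ s i j → explored (advance s (i , j)) (var (Φ i j)) ≡ true
  advance-explores-flipped s i j rewrite explored-advance s i j (var (Φ i j)) | ==F-refl (var (Φ i j)) =
    ∨-trueˡ _ (∨-trueʳ (A s (var (Φ i j))) refl)

  flipped-explored : ∀ s i j → ⁅ var (Φ i j) ⁆ₛ ⊆ₛ explored (advance s (i , j))
  flipped-explored s i j x x==y =
    subst (λ z → explored (advance s (i , j)) z ≡ true) (sym (==F⇒≡ x==y)) (advance-explores-flipped s i j)

  step-hiddenTrue : ∀ s c → HiddenTrue s → HiddenTrue (step Φ s c)
  step-hiddenTrue s (i , j) hidden x h with satisfies Φ (σ s) in running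
  ... | true = hidden x h
  ... | false = subst (λ b → (if b then not (σ s x) else σ s x) ≡ true) (sym (⊆ₛ-false (flipped-explored s i j) x h))
                      (hidden x (⊆ₛ-false (step-explored-⊇ s (i , j)) x
                                  (trans (cong (λ s' → explored s' x) (step-running s (i , j) running)) h)))

  run-explored-⊇ : ∀ s cs → explored s ⊆ₛ explored (run s cs)
  run-explored-⊇ s [] x h = h
  run-explored-⊇ s (c ∷ cs) x h = run-explored-⊇ (step Φ s c) cs x (step-explored-⊇ s c x h)

  run-hiddenTrue : ∀ s cs → HiddenTrue s → HiddenTrue (run s cs)
  run-hiddenTrue s [] h = h
  run-hiddenTrue s (c ∷ cs) h = run-hiddenTrue (step Φ s c) cs (step-hiddenTrue s c h)

  pi2Step-occur : ∀ Aold y (p : (Fin m → Bool) × VSet n) x → proj₂ (pi2Step Φ Aold y p) x ≡ true →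
    proj₂ p x ≡ true ⊎ (∃[ i ] ∃[ j ] var (Φ i j) ≡ x)
  pi2Step-occur Aold y (Zc , Nc) x h with firstFin m (pi2Cond Φ Aold y Zc Nc)
  ... | nothing = inj₁ h
  ... | just i with ∨-true⇒ {Nc x} h
  ...   | inj₁ a = inj₁ a
  ...   | inj₂ b with anyFin⇒ k b
  ...     | j , e = inj₂ (i , j , ==F⇒≡ e)

  iter-pi2Step-occur : ∀ r Aold y (p : (Fin m → Bool) × VSet n) x →
    proj₂ (iter Φ r (pi2Step Φ Aold y) p) x ≡ true →
    proj₂ p x ≡ true ⊎ (∃[ i ] ∃[ j ] var (Φ i j) ≡ x)
  iter-pi2Step-occur zero Aold y p x h = inj₁ h
  iter-pi2Step-occur (suc r) Aold y p x h with iter-pi2Step-occur r Aold y (pi2Step Φ Aold y p) x h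
  ... | inj₂ e = inj₂ e
  ... | inj₁ a = pi2Step-occur Aold y p x a

  step-exploredOccur : ∀ s c → ExploredOccur Φ s → ExploredOccur Φ (step Φ s c)
  step-exploredOccur s (i , j) occur x h with satisfies Φ (σ s)
  ... | true = occur x h
  ... | false rewrite explored-advance s i j x with ∨-true⇒ {A s x ∨ (x ==F var (Φ i j))} h
  ...   | inj₂ b with iter-pi2Step-occur m (A s) (var (Φ i j)) (Z s , N s) x b
  ...     | inj₂ e = e
  ...     | inj₁ Nx = occur x (∨-trueʳ (A s x) Nx)
  step-exploredOccur s (i , j) occur x h | false | inj₁ a with ∨-true⇒ {A s x} a
  ...   | inj₁ Ax = occur x (∨-trueˡ _ Ax)
  ...   | inj₂ x==y = i , j , sym (==F⇒≡ x==y)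

  run-exploredOccur : ∀ s cs → ExploredOccur Φ s → ExploredOccur Φ (run s cs)
  run-exploredOccur s [] h = h
  run-exploredOccur s (c ∷ cs) h = run-exploredOccur (step Φ s c) cs (step-exploredOccur s c h)

  step-A⇒ : ∀ s i j x → satisfies Φ (σ s) ≡ false → A (step Φ s (i , j)) x ≡ true →
    A s x ≡ true ⊎ (x ==F var (Φ i j)) ≡ true
  step-A⇒ s i j x h Ax rewrite step-running s (i , j) h = ∨-true⇒ (∧-trueˡ Ax)

  stepProb-satisfiedClause : ∀ s i j → satisfies Φ (σ s) ≡ false → clauseSat Φ (σ s) i ≡ true →
    stepProb Φ s (i , j) ≡ 0ℚ
  stepProb-satisfiedClause s i j running satisfied rewrite running | satisfied = refl

  run-take-last : ∀ s {t'} (cs : Vec (Fin m × Fin k) (suc t')) →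
    run s (take (suc t') (toList cs)) ≡ step Φ (run s (take t' (toList cs))) (V.last cs)
  run-take-last s (c V.∷ V.[]) = refl
  run-take-last s (c V.∷ c' V.∷ cs) = run-take-last (step Φ s c) (c' V.∷ cs)

  choicesProb-last : ∀ s {t'} (cs : Vec (Fin m × Fin k) (suc t')) →
    stepProb Φ (run s (take t' (toList cs))) (V.last cs) ≡ 0ℚ → choicesProb Φ s (toList cs) ≡ 0ℚ
  choicesProb-last s (c V.∷ V.[]) h = trans (cong (Q._* 1ℚ) h) (QP.*-zeroˡ 1ℚ)
  choicesProb-last s (c V.∷ c' V.∷ cs) h =
    trans (cong (stepProb Φ s c Q.*_) (choicesProb-last (step Φ s c) (c' V.∷ cs) h)) (QP.*-zeroʳ (stepProb Φ s c))

open Run public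

-- Coupled runs

∪ₛ-⊆ : ∀ {n} {S T R : VSet n} → S ⊆ₛ R → T ⊆ₛ R → (S ∪ₛ T) ⊆ₛ R
∪ₛ-⊆ {S = S} S⊆R T⊆R x h with ∨-true⇒ {S x} h
... | inj₁ Sx = S⊆R x Sx
... | inj₂ Tx = T⊆R x Tx

⁅⁆ₛ-⊆ : ∀ {n} {R : VSet n} {y} → R y ≡ true → ⁅ y ⁆ₛ ⊆ₛ R
⁅⁆ₛ-⊆ {R = R} Ry x x==y = subst (λ z → R z ≡ true) (sym (==F⇒≡ x==y)) Ry

Coupled : ∀ {k m n} → VSet n → Formula k m n → Formula k m n → Set
Coupled R₀ Φ Φ' = ∀ i j → Φ i j ≡ Φ' i j ⊎
  (positive (Φ i j) ≡ true × positive (Φ' i j) ≡ true × R₀ (var (Φ i j)) ≡ false × R₀ (var (Φ' i j)) ≡ false)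

record _≈ₛ_ {k m n} (s s' : State k m n) : Set where
  field
    σ-≗ : ∀ x → σ s x ≡ σ s' x
    A-≗ : ∀ x → A s x ≡ A s' x
    N-≗ : ∀ x → N s x ≡ N s' x
    Z-≗ : ∀ i → Z s i ≡ Z s' i
    last-≡ : last s ≡ last s'
open _≈ₛ_ public

state₀-≈ₛ : ∀ {k m n} (Φ Φ' : Formula k m n) → state₀ Φ ≈ₛ state₀ Φ'
state₀-≈ₛ Φ Φ' = record
  { σ-≗ = λ _ → refl ; A-≗ = λ _ → refl ; N-≗ = λ _ → refl ; Z-≗ = λ _ → refl ; last-≡ = refl }

_≈ᶻᴺ_ : ∀ {m n} → (Fin m → Bool) × VSet n → (Fin m → Bool) × VSet n → Set
p ≈ᶻᴺ p' = (∀ i → proj₁ p i ≡ proj₁ p' i) × (∀ x → proj₂ p x ≡ proj₂ p' x)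

module Coupling {k m n : ℕ} (Φ Φ' : Formula k m n) (R₀ : VSet n) (coupled : Coupled R₀ Φ Φ') where

  coupled-var : ∀ (S S' : VSet n) → S ⊆ₛ R₀ → (∀ x → S x ≡ S' x) →
    ∀ i j → S (var (Φ i j)) ≡ S' (var (Φ' i j))
  coupled-var S S' S⊆R₀ S≗S' i j with coupled i j
  ... | inj₁ e = trans (S≗S' _) (cong (S' ∘ var) e)
  ... | inj₂ (_ , _ , out , out') =
    trans (⊆ₛ-false S⊆R₀ _ out) (sym (trans (sym (S≗S' _)) (⊆ₛ-false S⊆R₀ _ out')))

  coupled-positive : ∀ i j → positive (Φ i j) ≡ positive (Φ' i j)
  coupled-positive i j with coupled i j
  ... | inj₁ e = cong positive e
  ... | inj₂ (pos , pos' , _ , _) = trans pos (sym pos')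

  coupled-inside : ∀ i j → R₀ (var (Φ i j)) ≡ true → Φ i j ≡ Φ' i j
  coupled-inside i j h with coupled i j
  ... | inj₁ e = e
  ... | inj₂ (_ , _ , out , _) = ⊥-elim (true≢false (trans (sym h) out))

  coupled-litTrue : ∀ (σ₁ σ₂ : Assignment n) → (∀ x → σ₁ x ≡ σ₂ x) → (∀ x → R₀ x ≡ false → σ₁ x ≡ true) →
    ∀ i j → litTrue σ₁ (Φ i j) ≡ litTrue σ₂ (Φ' i j)
  coupled-litTrue σ₁ σ₂ σ≗ outside-true i j with coupled i j
  ... | inj₁ e = trans (cong (litTrue σ₁) e) (cong (_==B positive (Φ' i j)) (σ≗ _))
  ... | inj₂ (pos , pos' , out , out')
    rewrite pos | pos' | outside-true _ out | sym (σ≗ (var (Φ' i j))) | outside-true _ out' = refl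

  module _ (s s' : State k m n) (s≈s' : s ≈ₛ s') (outside-true : ∀ x → R₀ x ≡ false → σ s x ≡ true) where

    clauseSat-coupled : ∀ i → clauseSat Φ (σ s) i ≡ clauseSat Φ' (σ s') i
    clauseSat-coupled i = anyFin-cong k (coupled-litTrue (σ s) (σ s') (σ-≗ s≈s') outside-true i)

    satisfies-coupled : satisfies Φ (σ s) ≡ satisfies Φ' (σ s')
    satisfies-coupled = allFin?-cong m clauseSat-coupled

    stepProb-coupled : ∀ c → stepProb Φ s c ≡ stepProb Φ' s' c
    stepProb-coupled (i , j) with satisfies Φ (σ s) | satisfies Φ' (σ s') | satisfies-coupled
    ... | true | .true | refl = refl
    ... | false | .false | refl =
      cong₂ (λ b r → if b then 0ℚ else r) (clauseSat-coupled i)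
            (cong (λ u → recipℕ (u ℕ.* k)) (countFin-cong m (λ i → cong not (clauseSat-coupled i))))

  module _ (Aold Aold' : VSet n) (y y' : Fin n) (Aold≗ : ∀ x → Aold x ≡ Aold' x) (Aold⊆R₀ : Aold ⊆ₛ R₀)
           (y≡y' : y ≡ y') (R₀y : R₀ y ≡ true) where

    pi2Cond-coupled : ∀ (Zc Zc' : Fin m → Bool) (Nc Nc' : VSet n) → (∀ i → Zc i ≡ Zc' i) → (∀ x → Nc x ≡ Nc' x) →
      Nc ⊆ₛ R₀ → ∀ i → pi2Cond Φ Aold y Zc Nc i ≡ pi2Cond Φ' Aold' y' Zc' Nc' i
    pi2Cond-coupled Zc Zc' Nc Nc' Zc≗ Nc≗ Nc⊆R₀ i rewrite y≡y' =
      cong₂ _∧_ (cong not (Zc≗ i))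
        (cong₂ _∧_ (allFin?-cong k (λ j → cong₂ (λ b v → if b then v else true) (coupled-positive i j)
                       (coupled-var _ _ (∪ₛ-⊆ (∪ₛ-⊆ Aold⊆R₀ Nc⊆R₀) (⁅⁆ₛ-⊆ R₀y))
                                    (λ x → cong₂ _∨_ (cong₂ _∨_ (Aold≗ x) (Nc≗ x)) refl) i j)))
          (cong₂ _∨_ (cong (λ c → ℕ._≤ᵇ_ (49 ℕ.* k) (100 ℕ.* c))
                           (countFin-cong k (λ j → coupled-var _ _ (∪ₛ-⊆ Aold⊆R₀ (⁅⁆ₛ-⊆ R₀y))
                                                            (λ x → cong₂ _∨_ (Aold≗ x) refl) i j)))
                     (cong (λ c → ℕ._<ᵇ_ k (c ℕ.* c)) (countFin-cong k (λ j → coupled-var Nc Nc' Nc⊆R₀ Nc≗ i j)))))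

    pi2Step-coupled : ∀ p p' → p ≈ᶻᴺ p' → proj₂ (pi2Step Φ Aold y p) ⊆ₛ R₀ →
      pi2Step Φ Aold y p ≈ᶻᴺ pi2Step Φ' Aold' y' p'
    pi2Step-coupled (Zc , Nc) (Zc' , Nc') (Zc≗ , Nc≗) ⊆R₀
      with firstFin m (pi2Cond Φ Aold y Zc Nc) in first | firstFin m (pi2Cond Φ' Aold' y' Zc' Nc')
         | firstFin-cong m (pi2Cond-coupled Zc Zc' Nc Nc' Zc≗ Nc≗
                             (λ x h → ⊆R₀ x (pi2Step-⊇ Φ Aold y (Zc , Nc) x h)))
    ... | nothing | .nothing | refl = Zc≗ , Nc≗
    ... | just i | .(just i) | refl =
      (λ i' → cong (_∨ (i' ==F i)) (Zc≗ i')) ,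
      (λ x → cong₂ _∨_ (Nc≗ x) (anyFin-cong k (λ j → cong (λ l → var l ==F x)
          (coupled-inside i j (clause⊆R₀ (var (Φ i j))
                                (∨-trueʳ (Nc _) (anyFin-intro k j (==F-refl (var (Φ i j))))))))))
      where
      clause⊆R₀ : (λ x → Nc x ∨ anyFin k (λ j → var (Φ i j) ==F x)) ⊆ₛ R₀
      clause⊆R₀ = subst (λ q → proj₂ q ⊆ₛ R₀) (pi2Step-just Φ Aold y Zc Nc i first) ⊆R₀

    iter-pi2Step-coupled : ∀ r p p' → p ≈ᶻᴺ p' → proj₂ (iter Φ r (pi2Step Φ Aold y) p) ⊆ₛ R₀ →
      iter Φ r (pi2Step Φ Aold y) p ≈ᶻᴺ iter Φ' r (pi2Step Φ' Aold' y') p'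
    iter-pi2Step-coupled zero p p' p≈p' ⊆R₀ = p≈p'
    iter-pi2Step-coupled (suc r) p p' p≈p' ⊆R₀ =
      iter-pi2Step-coupled r (pi2Step Φ Aold y p) (pi2Step Φ' Aold' y' p')
        (pi2Step-coupled p p' p≈p' (λ x h → ⊆R₀ x (iter-pi2Step-⊇ Φ r Aold y _ x h))) ⊆R₀

  advance-coupled : ∀ (s s' : State k m n) i j → s ≈ₛ s' → explored (advance Φ s (i , j)) ⊆ₛ R₀ →
    advance Φ s (i , j) ≈ₛ advance Φ' s' (i , j)
  advance-coupled s s' i j s≈s' ⊆R₀ = record
    { σ-≗ = λ x → cong₂ (λ b v → if b then not v else v) (cong (x ==F_) y≡y') (σ-≗ s≈s' x)
    ; A-≗ = λ x → cong₂ _∧_ (cong₂ _∨_ (A-≗ s≈s' x) (cong (x ==F_) y≡y')) (cong not (proj₂ ZN≈ x))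
    ; N-≗ = proj₂ ZN≈
    ; Z-≗ = proj₁ ZN≈
    ; last-≡ = refl }
    where
    y = var (Φ i j)
    inside : ∀ x → ((A s x ∨ (x ==F y)) ∨ proj₂ (pi2 Φ (A s) y (Z s , N s)) x) ≡ true → R₀ x ≡ true
    inside x h = ⊆R₀ x (trans (explored-advance Φ s i j x) h)
    R₀y : R₀ y ≡ true
    R₀y = inside y (∨-trueˡ _ (∨-trueʳ (A s y) (==F-refl y)))
    y≡y' : y ≡ var (Φ' i j)
    y≡y' = cong var (coupled-inside i j R₀y)
    ZN≈ = iter-pi2Step-coupled (A s) (A s') y _ (A-≗ s≈s') (λ x h → inside x (∨-trueˡ _ (∨-trueˡ _ h)))
            y≡y' R₀y m
            (Z s , N s) (Z s' , N s') (Z-≗ s≈s' , N-≗ s≈s') (λ x h → inside x (∨-trueʳ _ h))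

  step-coupled : ∀ (s s' : State k m n) c → s ≈ₛ s' → HiddenTrue s → explored (step Φ s c) ⊆ₛ R₀ →
    step Φ s c ≈ₛ step Φ' s' c
  step-coupled s s' (i , j) s≈s' hidden ⊆R₀
    with satisfies Φ (σ s) in running | satisfies Φ' (σ s')
       | satisfies-coupled s s' s≈s' (hiddenTrue-outside s hidden (λ x h → ⊆R₀ x (step-explored-⊇ Φ s (i , j) x h)))
  ... | true | .true | refl = s≈s'
  ... | false | .false | refl =
    advance-coupled s s' i j s≈s' (subst (λ z → explored z ⊆ₛ R₀) (step-running Φ s (i , j) running) ⊆R₀)

  run-coupled : ∀ (cs : List (Fin m × Fin k)) r (s s' : State k m n) → s ≈ₛ s' → HiddenTrue s →
    explored (run Φ s (take r cs)) ⊆ₛ R₀ →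
    (∀ r' → r' ℕ.≤ r →
      run Φ s (take r' cs) ≈ₛ run Φ' s' (take r' cs) × explored (run Φ s (take r' cs)) ⊆ₛ R₀)
    × (choicesProb Φ s (take (suc r) cs) ≡ choicesProb Φ' s' (take (suc r) cs))
  run-coupled [] zero s s' s≈s' hidden ⊆R₀ = (λ { zero _ → s≈s' , ⊆R₀ }) , refl
  run-coupled [] (suc r) s s' s≈s' hidden ⊆R₀ = (λ { zero _ → s≈s' , ⊆R₀ ; (suc _) _ → s≈s' , ⊆R₀ }) , refl
  run-coupled (c ∷ cs) zero s s' s≈s' hidden ⊆R₀ =
    (λ { zero _ → s≈s' , ⊆R₀ }) ,
    cong (Q._* 1ℚ) (stepProb-coupled s s' s≈s' (hiddenTrue-outside s hidden ⊆R₀) c)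
  run-coupled (c ∷ cs) (suc r) s s' s≈s' hidden ⊆R₀ =
    (λ { zero _ → s≈s' , s⊆R₀ ; (suc r') (ℕ.s≤s r'≤r) → proj₁ IH r' r'≤r }) ,
    cong₂ Q._*_ (stepProb-coupled s s' s≈s' (hiddenTrue-outside s hidden s⊆R₀) c) (proj₂ IH)
    where
    s⊆R₀ : explored s ⊆ₛ R₀
    s⊆R₀ x h = ⊆R₀ x (run-explored-⊇ Φ s (c ∷ take r cs) x h)
    IH = run-coupled cs r (step Φ s c) (step Φ' s' c)
           (step-coupled s s' c s≈s' hidden (λ x h → ⊆R₀ x (run-explored-⊇ Φ (step Φ s c) (take r cs) x h)))
           (step-hiddenTrue Φ s c hidden) ⊆R₀

  piOf-coupled : ∀ (s s' : State k m n) → s ≈ₛ s' → explored s ⊆ₛ R₀ → ∀ i j → piOf Φ s i j ≡ piOf Φ' s' i j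
  piOf-coupled s s' s≈s' ⊆R₀ i j =
    go (explored s (var (Φ i j))) (explored s' (var (Φ' i j))) refl refl
       (coupled-var (explored s) (explored s') ⊆R₀ (λ x → cong₂ _∨_ (A-≗ s≈s' x) (N-≗ s≈s' x)) i j)
    where
    go : ∀ b b' → explored s (var (Φ i j)) ≡ b → explored s' (var (Φ' i j)) ≡ b' → b ≡ b' →
      piOf Φ s i j ≡ piOf Φ' s' i j
    go true .true e e' refl rewrite e | e' = cong revealed (coupled-inside i j (⊆R₀ _ e))
    go false .false e e' refl rewrite e | e' = cong sgn (coupled-positive i j)

-- What F_{t-1} observes

piOf-explored : ∀ {k m n} (Φ : Formula k m n) s i j → explored s (var (Φ i j)) ≡ true →
  piOf Φ s i j ≡ revealed (Φ i j)
piOf-explored Φ s i j h rewrite h = refl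

piOf-unexplored : ∀ {k m n} (Φ : Formula k m n) s i j → explored s (var (Φ i j)) ≡ false →
  piOf Φ s i j ≡ sgn (positive (Φ i j))
piOf-unexplored Φ s i j h rewrite h = refl

piOf-sgn-true⇒ : ∀ {k m n} (Φ : Formula k m n) s i j → piEq (piOf Φ s i j) (sgn true) ≡ true →
  explored s (var (Φ i j)) ≡ false × positive (Φ i j) ≡ true
piOf-sgn-true⇒ Φ s i j h with explored s (var (Φ i j)) in e
... | false = refl , ==B-true h
  where
  ==B-true : ∀ {b} → (b ==B true) ≡ true → b ≡ true
  ==B-true {true} _ = refl

piEq-sym : ∀ {n} (π π' : PiVal n) → piEq π π' ≡ piEq π' π
piEq-sym (revealed l) (revealed l') = cong₂ _∧_ (==F-sym (var l) (var l')) (==B-sym (positive l) (positive l'))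
  where
  ==B-sym : ∀ a b → (a ==B b) ≡ (b ==B a)
  ==B-sym true true = refl
  ==B-sym true false = refl
  ==B-sym false true = refl
  ==B-sym false false = refl
piEq-sym (revealed l) (sgn b) = refl
piEq-sym (sgn b) (revealed l) = refl
piEq-sym (sgn true) (sgn true) = refl
piEq-sym (sgn true) (sgn false) = refl
piEq-sym (sgn false) (sgn true) = refl
piEq-sym (sgn false) (sgn false) = refl

-- An explored variable occurs at some position, and π shows the other run has explored that position too.
sameπ⇒explored-⊆ : ∀ {k m n} (Φ Φ' : Formula k m n) (s s' : State k m n) → ExploredOccur Φ s →
  (∀ i j → piEq (piOf Φ s i j) (piOf Φ' s' i j) ≡ true) → explored s ⊆ₛ explored s'
sameπ⇒explored-⊆ Φ Φ' s s' occur sameπ x h with occur x h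
... | i , j , refl = go (explored s' (var (Φ' i j))) refl
  where
  same : ∀ {π} → piOf Φ' s' i j ≡ π → piEq (revealed (Φ i j)) π ≡ true
  same refl = subst (λ π → piEq π (piOf Φ' s' i j) ≡ true) (piOf-explored Φ s i j h) (sameπ i j)
  go : ∀ b → explored s' (var (Φ' i j)) ≡ b → explored s' (var (Φ i j)) ≡ true
  go true e = subst (λ z → explored s' z ≡ true) (sym (==F⇒≡ (∧-trueˡ (same (piOf-explored Φ' s' i j e))))) e
  go false e with same (piOf-unexplored Φ' s' i j e)
  ... | ()

and-applyUpTo-cong : ∀ {X : Set} (f g : X → Bool) (h : ℕ → X) N → (∀ s → s ℕ.< N → f (h s) ≡ g (h s)) →
  foldr _∧_ true (map f (applyUpTo h N)) ≡ foldr _∧_ true (map g (applyUpTo h N))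
and-applyUpTo-cong f g h zero e = refl
and-applyUpTo-cong f g h (suc N) e =
  cong₂ _∧_ (e 0 (ℕ.s≤s ℕ.z≤n)) (and-applyUpTo-cong f g (h ∘ suc) N (λ s lt → e (suc s) (ℕ.s≤s lt)))

and-applyUpTo⇒ : ∀ {X : Set} (f : X → Bool) (h : ℕ → X) N → foldr _∧_ true (map f (applyUpTo h N)) ≡ true →
  ∀ s → s ℕ.< N → f (h s) ≡ true
and-applyUpTo⇒ f h (suc N) e zero _ = ∧-trueˡ e
and-applyUpTo⇒ f h (suc N) e (suc s) (ℕ.s≤s lt) = and-applyUpTo⇒ f (h ∘ suc) N (∧-trueʳ {f (h 0)} e) s lt

take-toList : ∀ {X : Set} {t} (cs : Vec X t) → take t (toList cs) ≡ toList cs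
take-toList {t = t} cs = LP.take-all t (toList cs) (ℕP.≤-reflexive (VP.length-toList cs))

module Observation {k m n t' : ℕ} where

  Ω : Set
  Ω = Outcome k m n (suc t')

  exploredBefore : Ω → VSet n
  exploredBefore ω = explored (stateAt ω t')

  lastChoice : Ω → Fin m × Fin k
  lastChoice ω = V.last (proj₂ ω)

  at : Formula k m n → Fin m × Fin k → Lit n
  at Φ (i , j) = Φ i j

  -- y_t, when the process is still running at time t - 1
  flipped : Ω → Fin n
  flipped ω = var (at (proj₁ ω) (lastChoice ω))

  hiddenPositive : Fin m × Fin k → Ω → Bool
  hiddenPositive (i , j) ω = piEq (piOf (proj₁ ω) (stateAt ω t') i j) (sgn true)

  running : Ω → Bool
  running ω = not (satisfies (proj₁ ω) (σ (stateAt ω t')))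

  hit : Fin m × Fin k → Ω → Bool
  hit q ω = hiddenPositive q ω ∧ (running ω ∧ (flipped ω ==F var (at (proj₁ ω) q)))

  -- Kstar (suc t') ω i j is the indicator of kstar (i , j) ω
  kstar : Fin m × Fin k → Ω → Bool
  kstar (i , j) ω = piEq (piOf (proj₁ ω) (stateAt ω t') i j) (sgn true) ∧ positive (proj₁ ω i j)
                    ∧ A (stateAt ω (suc t')) (var (proj₁ ω i j))

  stateAt-suc : ∀ (ω : Ω) → stateAt ω (suc t') ≡ step (proj₁ ω) (stateAt ω t') (lastChoice ω)
  stateAt-suc (Φ , cs) = run-take-last Φ (state₀ Φ) cs

  hiddenTrueAt : ∀ (ω : Ω) r → HiddenTrue (stateAt ω r)
  hiddenTrueAt (Φ , cs) r = run-hiddenTrue Φ (state₀ Φ) (take r (toList cs)) (λ _ _ → refl)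

  exploredOccurAt : ∀ (ω : Ω) r → ExploredOccur (proj₁ ω) (stateAt ω r)
  exploredOccurAt (Φ , cs) r = run-exploredOccur Φ (state₀ Φ) (take r (toList cs)) (λ _ ())

  -- a variable entering A at step t was not in A before, so it is y_t and the process was running
  kstar⇒hit : ∀ q ω → kstar q ω ≡ true → hit q ω ≡ true
  kstar⇒hit (i , j) (Φ , cs) h = ∧-true hidden (∧-true running≡true (trans (==F-sym (flipped (Φ , cs)) x) x==y))
    where
    s = stateAt (Φ , cs) t'
    x = var (Φ i j)
    hidden = ∧-trueˡ h
    x∉A : A s x ≡ false
    x∉A = ⊆ₛ-false {S = A s} (λ z Az → ∨-trueˡ (N s z) Az) x (proj₁ (piOf-sgn-true⇒ Φ s i j hidden))
    x∈A' : A (step Φ s (lastChoice (Φ , cs))) x ≡ true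
    x∈A' = subst (λ s' → A s' x ≡ true) (stateAt-suc (Φ , cs))
                 (∧-trueʳ {positive (Φ i j)} (∧-trueʳ {piEq (piOf Φ s i j) (sgn true)} h))
    notStopped : satisfies Φ (σ s) ≡ false
    notStopped with satisfies Φ (σ s) in stopped
    ... | false = refl
    ... | true =
      ⊥-elim (true≢false (trans (sym (subst (λ s' → A s' x ≡ true) (step-stopped Φ s _ stopped) x∈A')) x∉A))
    running≡true : running (Φ , cs) ≡ true
    running≡true = cong not notStopped
    x==y : (x ==F flipped (Φ , cs)) ≡ true
    x==y with step-A⇒ Φ s (proj₁ (lastChoice (Φ , cs))) (proj₂ (lastChoice (Φ , cs))) x notStopped x∈A'
    ... | inj₁ Ax = ⊥-elim (true≢false (trans (sym Ax) x∉A))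
    ... | inj₂ e = e

  sameInfo⇒sameπ : ∀ (ω₀ ω : Ω) → sameInfo t' ω₀ ω ≡ true →
    ∀ i j → piEq (piOf (proj₁ ω₀) (stateAt ω₀ t') i j) (piOf (proj₁ ω) (stateAt ω t') i j) ≡ true
  sameInfo⇒sameπ ω₀ ω h i j =
    allFin?⇒ k (allFin?⇒ m (∧-trueˡ (and-applyUpTo⇒ _ id (suc t') h t' ℕP.≤-refl)) i) j

  sameInfo⇒exploredBefore : ∀ (ω₀ ω : Ω) → sameInfo t' ω₀ ω ≡ true →
    ∀ x → exploredBefore ω₀ x ≡ exploredBefore ω x
  sameInfo⇒exploredBefore ω₀ ω h x = true⇔true⇒≡
    (sameπ⇒explored-⊆ (proj₁ ω₀) (proj₁ ω) (stateAt ω₀ t') (stateAt ω t') (exploredOccurAt ω₀ t')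
                      (sameInfo⇒sameπ ω₀ ω h) x)
    (sameπ⇒explored-⊆ (proj₁ ω) (proj₁ ω₀) (stateAt ω t') (stateAt ω₀ t') (exploredOccurAt ω t')
       (λ i j → trans (piEq-sym (piOf (proj₁ ω) (stateAt ω t') i j) (piOf (proj₁ ω₀) (stateAt ω₀ t') i j))
                      (sameInfo⇒sameπ ω₀ ω h i j)) x)

  module CoupledOutcomes (Φ₁ Φ₂ : Formula k m n) (cs : Vec (Fin m × Fin k) (suc t'))
                         (coupled : Coupled (exploredBefore (Φ₁ , cs)) Φ₁ Φ₂) where

    open Coupling Φ₁ Φ₂ (exploredBefore (Φ₁ , cs)) coupled

    private
      runs = run-coupled (toList cs) t' (state₀ Φ₁) (state₀ Φ₂) (state₀-≈ₛ Φ₁ Φ₂) (λ _ _ → refl) (λ x h → h)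

    stateAt-coupled : ∀ r → r ℕ.≤ t' →
      stateAt (Φ₁ , cs) r ≈ₛ stateAt (Φ₂ , cs) r × explored (stateAt (Φ₁ , cs) r) ⊆ₛ exploredBefore (Φ₁ , cs)
    stateAt-coupled = proj₁ runs

    prob-coupled : prob (Φ₁ , cs) ≡ prob (Φ₂ , cs)
    prob-coupled = cong (powℚ (recipℕ (2 ℕ.* n)) (k ℕ.* m) Q.*_)
      (subst (λ l → choicesProb Φ₁ (state₀ Φ₁) l ≡ choicesProb Φ₂ (state₀ Φ₂) l) (take-toList cs) (proj₂ runs))

    πAt-coupled : ∀ r → r ℕ.≤ t' → ∀ i j → piOf Φ₁ (stateAt (Φ₁ , cs) r) i j ≡ piOf Φ₂ (stateAt (Φ₂ , cs) r) i j
    πAt-coupled r r≤t' = piOf-coupled _ _ (proj₁ (stateAt-coupled r r≤t')) (proj₂ (stateAt-coupled r r≤t'))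

    sameInfo-coupled : ∀ (ω₀ : Ω) → sameInfo t' ω₀ (Φ₁ , cs) ≡ sameInfo t' ω₀ (Φ₂ , cs)
    sameInfo-coupled ω₀ = and-applyUpTo-cong _ _ id (suc t') λ r r<t →
      cong₂ _∧_ (allFin?-cong m (λ i → allFin?-cong k (λ j →
                   cong (piEq (piOf (proj₁ ω₀) (stateAt ω₀ r) i j)) (πAt-coupled r (ℕP.≤-pred r<t) i j))))
                (cong (idxEq (last (stateAt ω₀ r))) (last-≡ (proj₁ (stateAt-coupled r (ℕP.≤-pred r<t)))))

    hiddenPositive-coupled : ∀ q → hiddenPositive q (Φ₁ , cs) ≡ hiddenPositive q (Φ₂ , cs)
    hiddenPositive-coupled (i , j) = cong (λ π → piEq π (sgn true)) (πAt-coupled t' ℕP.≤-refl i j)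

    running-coupled : running (Φ₁ , cs) ≡ running (Φ₂ , cs)
    running-coupled = cong not (satisfies-coupled (stateAt (Φ₁ , cs) t') (stateAt (Φ₂ , cs) t')
      (proj₁ (stateAt-coupled t' ℕP.≤-refl))
      (hiddenTrue-outside (stateAt (Φ₁ , cs) t') (hiddenTrueAt (Φ₁ , cs) t')
                          (proj₂ (stateAt-coupled t' ℕP.≤-refl))))

    -- a clause containing a true literal is never chosen, so the flipped position is not a coupled one
    lastChoice-coupled : prob (Φ₁ , cs) ≢ 0ℚ → running (Φ₁ , cs) ≡ true →
      at Φ₁ (lastChoice (Φ₁ , cs)) ≡ at Φ₂ (lastChoice (Φ₁ , cs))
    lastChoice-coupled prob≢0 running≡true with lastChoice (Φ₁ , cs) in last≡
    ... | i , j with coupled i j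
    ...   | inj₁ e = e
    ...   | inj₂ (pos , _ , out , _) = ⊥-elim (prob≢0 (trans (cong (powℚ (recipℕ (2 ℕ.* n)) (k ℕ.* m) Q.*_) choices≡0)
                                                             (QP.*-zeroʳ (powℚ (recipℕ (2 ℕ.* n)) (k ℕ.* m)))))
      where
      s = stateAt (Φ₁ , cs) t'
      litTrue≡true : litTrue (σ s) (Φ₁ i j) ≡ true
      litTrue≡true rewrite hiddenTrueAt (Φ₁ , cs) t' (var (Φ₁ i j)) out | pos = refl
      stepProb≡0 : stepProb Φ₁ s (i , j) ≡ 0ℚ
      stepProb≡0 = stepProb-satisfiedClause Φ₁ s i j (not-true⇒ running≡true) (anyFin-intro k j litTrue≡true)
      choices≡0 : choicesProb Φ₁ (state₀ Φ₁) (toList cs) ≡ 0ℚ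
      choices≡0 =
        choicesProb-last Φ₁ (state₀ Φ₁) cs (subst (λ c → stepProb Φ₁ s c ≡ 0ℚ) (sym last≡) stepProb≡0)

prob-nonNeg : ∀ {k m n t} (ω : Outcome k m n t) → 0ℚ Q.≤ prob ω
prob-nonNeg {k} {m} {n} (Φ , cs) = 0≤-* (pow-nonNeg (k ℕ.* m)) (choices-nonNeg (state₀ Φ) (toList cs))
  where
  pow-nonNeg : ∀ e → 0ℚ Q.≤ powℚ (recipℕ (2 ℕ.* n)) e
  pow-nonNeg zero = 0≤1
  pow-nonNeg (suc e) = 0≤-* (0≤-recipℕ (2 ℕ.* n)) (pow-nonNeg e)
  stepProb-nonNeg : ∀ s c → 0ℚ Q.≤ stepProb Φ s c
  stepProb-nonNeg s (i , j) with satisfies Φ (σ s)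
  ... | true = 0≤-recipℕ (m ℕ.* k)
  ... | false with clauseSat Φ (σ s) i
  ...   | true = QP.≤-refl
  ...   | false = 0≤-recipℕ (numUnsat Φ (σ s) ℕ.* k)
  choices-nonNeg : ∀ s cs → 0ℚ Q.≤ choicesProb Φ s cs
  choices-nonNeg s [] = 0≤1
  choices-nonNeg s (c ∷ cs) = 0≤-* (stepProb-nonNeg s c) (choices-nonNeg (step Φ s c) cs)

-- The swap argument

transpose-==F : ∀ {n} (y a v : Fin n) → (PC.transpose y a v ==F a) ≡ (v ==F y)
transpose-==F y a v with v ==F y in v==y
... | true = ==F-refl a
... | false with v ==F a in v==a
...   | true = ≢⇒==F-false λ y≡a →
    true≢false (trans (sym (subst (λ z → (v ==F z) ≡ true) (sym y≡a) v==a)) v==y)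
...   | false = v==a

transpose-matchˡ : ∀ {n} (y a v : Fin n) → (v ==F y) ≡ true → PC.transpose y a v ≡ a
transpose-matchˡ y a v h with v ==F y
... | true = refl

transposeAt-at : ∀ {k m n} (i : Fin m) (j : Fin k) (a b : Fin n) Φ →
  transposeAt i j a b Φ i j ≡ transposeVar a b (Φ i j)
transposeAt-at i j a b Φ = trans (cong (λ r → r j) (VFP.updateAt-updates i Φ)) (VFP.updateAt-updates j (Φ i))

transposeAt-elsewhere : ∀ {k m n} (i : Fin m) (j : Fin k) (a b : Fin n) Φ i' j' → (i , j) ≢ (i' , j') →
  transposeAt i j a b Φ i' j' ≡ Φ i' j'
transposeAt-elsewhere i j a b Φ i' j' ne with i F.≟ i'
... | no i≢i' = cong (λ r → r j') (VFP.updateAt-minimal i' i Φ (i≢i' ∘ sym))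
... | yes refl with j F.≟ j'
...   | yes refl = ⊥-elim (ne refl)
...   | no j≢j' = trans (cong (λ r → r j') (VFP.updateAt-updates i Φ)) (VFP.updateAt-minimal j' j (Φ i) (j≢j' ∘ sym))

module SwapArgument {k m n t' : ℕ} (ω₀ : Outcome k m n (suc t')) where

  open Observation {k} {m} {n} {t'}

  outcomes : List Ω
  outcomes = allOutcomes k m n (suc t')

  informed : Ω → Bool
  informed ω = sameInfo t' ω₀ ω

  hitsAll : List (Fin m × Fin k) → Ω → Bool
  hitsAll J ω = informed ω ∧ BL.all (λ q → hit q ω) J

  weight : (Ω → Bool) → Ω → ℚ
  weight E ω = when (E ω) (prob ω)

  Pr : (Ω → Bool) → ℚ
  Pr E = sumOver outcomes (weight E)

  free : Fin n → Bool
  free a = not (exploredBefore ω₀ a)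

  U : ℕ
  U = countFin n free

  eligible : Fin m × Fin k → List (Fin m × Fin k) → Ω → Bool
  eligible p J ω = hitsAll J ω ∧ (hiddenPositive p ω ∧ running ω)

  flipsTo : Fin m × Fin k → List (Fin m × Fin k) → Fin n → Ω → ℚ
  flipsTo p J y ω = when (flipped ω ==F y) (when (eligible p J ω) (prob ω))

  placed : Fin m × Fin k → List (Fin m × Fin k) → Fin n → Fin n → Ω → ℚ
  placed p J a y ω = when (var (at (proj₁ ω) p) ==F a) (when (free a) (flipsTo p J y ω))

  0≤-placed : ∀ p J a y ω → 0ℚ Q.≤ placed p J a y ω
  0≤-placed p J a y ω =
    0≤-when (var (at (proj₁ ω) p) ==F a) (0≤-when (free a)
      (0≤-when (flipped ω ==F y) (0≤-when (eligible p J ω) (prob-nonNeg ω))))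

  hitsAll-coupled : ∀ (Φ₁ Φ₂ : Formula k m n) cs (coupled : Coupled (exploredBefore (Φ₁ , cs)) Φ₁ Φ₂) →
    flipped (Φ₁ , cs) ≡ flipped (Φ₂ , cs) → ∀ J → All (λ q → at Φ₁ q ≡ at Φ₂ q) J →
    hitsAll J (Φ₁ , cs) ≡ hitsAll J (Φ₂ , cs)
  hitsAll-coupled Φ₁ Φ₂ cs coupled flipped≡ J agree = cong₂ _∧_ (sameInfo-coupled ω₀) (all-hit J agree)
    where
    open CoupledOutcomes Φ₁ Φ₂ cs coupled
    all-hit : ∀ J → All (λ q → at Φ₁ q ≡ at Φ₂ q) J →
      BL.all (λ q → hit q (Φ₁ , cs)) J ≡ BL.all (λ q → hit q (Φ₂ , cs)) J
    all-hit [] [] = refl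
    all-hit (q ∷ J) (e ∷ es) =
      cong₂ _∧_ (cong₂ _∧_ (hiddenPositive-coupled q) (cong₂ _∧_ running-coupled (cong₂ _==F_ flipped≡ (cong var e))))
                (all-hit J es)

  flipsTo-prob≡0 : ∀ p J y ω → prob ω ≡ 0ℚ → flipsTo p J y ω ≡ 0ℚ
  flipsTo-prob≡0 p J y ω prob≡0 =
    trans (cong (λ r → when (flipped ω ==F y) (when (eligible p J ω) r)) prob≡0)
          (trans (cong (when (flipped ω ==F y)) (when-0 (eligible p J ω))) (when-0 (flipped ω ==F y)))

  eligible⇒informed : ∀ {p J ω} → eligible p J ω ≡ true → informed ω ≡ true
  eligible⇒informed h = ∧-trueˡ (∧-trueˡ h)

  eligible⇒hiddenPositive : ∀ {p J ω} → eligible p J ω ≡ true → hiddenPositive p ω ≡ true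
  eligible⇒hiddenPositive {J = J} {ω} h = ∧-trueˡ (∧-trueʳ {hitsAll J ω} h)

  eligible⇒running : ∀ {p J ω} → eligible p J ω ≡ true → running ω ≡ true
  eligible⇒running {p} {J} {ω} h = ∧-trueʳ {hiddenPositive p ω} (∧-trueʳ {hitsAll J ω} h)

  coupledAt : ∀ i j J (Φ₁ Φ₂ : Formula k m n) cs → (∀ q → (i , j) ≢ q → at Φ₁ q ≡ at Φ₂ q) →
    positive (Φ₂ i j) ≡ positive (Φ₁ i j) → free (var (Φ₂ i j)) ≡ true → eligible (i , j) J (Φ₁ , cs) ≡ true →
    Coupled (exploredBefore (Φ₁ , cs)) Φ₁ Φ₂
  coupledAt i j J Φ₁ Φ₂ cs elsewhere pos≡ free₂ elig i' j' with ×P.≡-dec F._≟_ F._≟_ (i , j) (i' , j')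
  ... | no ne = inj₁ (elsewhere (i' , j') ne)
  ... | yes refl = inj₂ (proj₂ hidden₁ , trans pos≡ (proj₂ hidden₁) , proj₁ hidden₁ , hidden₂)
    where
    hidden₁ = piOf-sgn-true⇒ Φ₁ (stateAt (Φ₁ , cs) t') i j (eligible⇒hiddenPositive {J = J} elig)
    hidden₂ = trans (sym (sameInfo⇒exploredBefore ω₀ (Φ₁ , cs) (eligible⇒informed {J = J} elig) (var (Φ₂ i j))))
                    (not-true⇒ free₂)

  -- Replacing the literal at a hidden positive position p by another positive literal on a free
  -- variable couples the two runs, so an eligible outcome keeps its mass and its flipped variable.
  flipsTo-resample : ∀ p J → All (p ≢_) J → ∀ (Φ₁ Φ₂ : Formula k m n) cs y →
    (∀ q → p ≢ q → at Φ₁ q ≡ at Φ₂ q) → positive (at Φ₂ p) ≡ positive (at Φ₁ p) →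
    free (var (at Φ₂ p)) ≡ true →
    eligible p J (Φ₁ , cs) ≡ true → flipsTo p J y (Φ₁ , cs) ≡ flipsTo p J y (Φ₂ , cs)
  flipsTo-resample (i , j) J p∉J Φ₁ Φ₂ cs y elsewhere pos≡ free₂ elig with prob (Φ₁ , cs) QP.≟ 0ℚ
  ... | yes prob≡0 = trans (flipsTo-prob≡0 (i , j) J y (Φ₁ , cs) prob≡0)
                           (sym (flipsTo-prob≡0 (i , j) J y (Φ₂ , cs) (trans (sym prob-coupled) prob≡0)))
    where open CoupledOutcomes Φ₁ Φ₂ cs (coupledAt i j J Φ₁ Φ₂ cs elsewhere pos≡ free₂ elig)
  ... | no prob≢0 = cong₂ when (cong (λ l → var l ==F y) (lastChoice-coupled prob≢0 running₁))
                               (cong₂ when (cong₂ _∧_ (hitsAll-coupled Φ₁ Φ₂ cs coupled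
                                                         (cong var (lastChoice-coupled prob≢0 running₁)) J
                                                         (All.map (elsewhere _) p∉J))
                                                      (cong₂ _∧_ (hiddenPositive-coupled (i , j)) running-coupled))
                                           prob-coupled)
    where
    coupled = coupledAt i j J Φ₁ Φ₂ cs elsewhere pos≡ free₂ elig
    open CoupledOutcomes Φ₁ Φ₂ cs coupled
    running₁ = eligible⇒running {J = J} elig

  flipsTo-ineligible : ∀ p J y ω → eligible p J ω ≡ false → flipsTo p J y ω ≡ 0ℚ
  flipsTo-ineligible p J y ω h =
    trans (cong (λ b → when (flipped ω ==F y) (when b (prob ω))) h) (when-0 (flipped ω ==F y))

  flipsTo-transposeAt : ∀ i j J → All ((i , j) ≢_) J → ∀ a y → free a ≡ true → free y ≡ true → ∀ Φ cs →
    (var (Φ i j) ==F y) ≡ true → flipsTo (i , j) J y (transposeAt i j y a Φ , cs) ≡ flipsTo (i , j) J y (Φ , cs)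
  flipsTo-transposeAt i j J p∉J a y free-a free-y Φ cs v==y =
    go (eligible (i , j) J (Φ , cs)) (eligible (i , j) J (Φ* , cs)) refl refl
    where
    Φ* = transposeAt i j y a Φ
    pos* = cong positive (transposeAt-at i j y a Φ)
    go : ∀ b b* → eligible (i , j) J (Φ , cs) ≡ b → eligible (i , j) J (Φ* , cs) ≡ b* →
      flipsTo (i , j) J y (Φ* , cs) ≡ flipsTo (i , j) J y (Φ , cs)
    go true _ elig _ = sym (flipsTo-resample (i , j) J p∉J Φ Φ* cs y
                              (λ (i' , j') ne → sym (transposeAt-elsewhere i j y a Φ i' j' ne)) pos* free* elig)
      where
      free* = subst (λ z → free z ≡ true)
                    (sym (trans (cong var (transposeAt-at i j y a Φ)) (transpose-matchˡ y a (var (Φ i j)) v==y))) free-a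
    go false true _ elig* = flipsTo-resample (i , j) J p∉J Φ* Φ cs y
                              (λ (i' , j') ne → transposeAt-elsewhere i j y a Φ i' j' ne) (sym pos*)
                              (subst (λ z → free z ≡ true) (sym (==F⇒≡ v==y)) free-y) elig*
    go false false elig elig* = trans (flipsTo-ineligible (i , j) J y _ elig*) (sym (flipsTo-ineligible (i , j) J y _ elig))

  placed-transposeAt : ∀ i j J → All ((i , j) ≢_) J → ∀ a y → free a ≡ true → free y ≡ true → ∀ Φ cs →
    placed (i , j) J a y (transposeAt i j y a Φ , cs) ≡ placed (i , j) J y y (Φ , cs)
  placed-transposeAt i j J p∉J a y free-a free-y Φ cs =
    trans (cong (λ b → when b (when (free a) (flipsTo (i , j) J y (transposeAt i j y a Φ , cs))))
                (trans (cong (λ l → var l ==F a) (transposeAt-at i j y a Φ)) (transpose-==F y a (var (Φ i j)))))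
          (go (var (Φ i j) ==F y) refl)
    where
    go : ∀ b → (var (Φ i j) ==F y) ≡ b →
      when b (when (free a) (flipsTo (i , j) J y (transposeAt i j y a Φ , cs))) ≡ placed (i , j) J y y (Φ , cs)
    go false e rewrite e = refl
    go true e rewrite e | free-a | free-y = flipsTo-transposeAt i j J p∉J a y free-a free-y Φ cs e

  placed-≗ᶠ : ∀ p J a y (Φ Φ' : Formula k m n) cs → Φ ≗ᶠ Φ' →
    placed p J a y (Φ , cs) ≡ placed p J a y (Φ' , cs)
  placed-≗ᶠ (i , j) J a y Φ Φ' cs Φ≗Φ' =
    cong₂ when (cong (λ l → var l ==F a) (Φ≗Φ' i j))
      (cong (when (free a)) (cong₂ when (cong (λ l → var l ==F y) (Φ≗Φ' _ _))
        (cong₂ when (cong₂ _∧_ (hitsAll-coupled Φ Φ' cs coupled (cong var (Φ≗Φ' _ _)) J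
                                  (All.universal (λ (i' , j') → Φ≗Φ' i' j') J))
                               (cong₂ _∧_ (hiddenPositive-coupled (i , j)) running-coupled))
                    prob-coupled)))
    where
    coupled : Coupled (exploredBefore (Φ , cs)) Φ Φ'
    coupled i' j' = inj₁ (Φ≗Φ' i' j')
    open CoupledOutcomes Φ Φ' cs coupled

  -- The transposition (y a) at position p is a measure-preserving bijection of outcomes.
  sumOver-placed-transposeAt : ∀ p J → All (p ≢_) J → ∀ a y → free a ≡ true → free y ≡ true →
    sumOver outcomes (placed p J y y) ≡ sumOver outcomes (placed p J a y)
  sumOver-placed-transposeAt (i , j) J p∉J a y free-a free-y = begin
    sumOver outcomes (placed (i , j) J y y)
      ≡⟨ sumOver-cartesianProduct (allFormulas k m n) choiceSeqs _ ⟩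
    sumOver (allFormulas k m n) (λ Φ → sumOver choiceSeqs (λ cs → placed (i , j) J y y (Φ , cs)))
      ≡⟨ sumOver-cong (allFormulas k m n) (λ Φ → sumOver-cong choiceSeqs (λ cs →
           placed-transposeAt i j J p∉J a y free-a free-y Φ cs)) ⟨
    sumOver (allFormulas k m n) (G ∘ transposeAt i j y a)
      ≡⟨ sumOver-allFormulas-transposeAt k m n i j y a G
           (λ Φ≗Φ' → sumOver-cong choiceSeqs (λ cs → placed-≗ᶠ (i , j) J a y _ _ cs Φ≗Φ')) ⟩
    sumOver (allFormulas k m n) G
      ≡⟨ sumOver-cartesianProduct (allFormulas k m n) choiceSeqs _ ⟨
    sumOver outcomes (placed (i , j) J a y) ∎
    where
    open ≡-Reasoning
    choiceSeqs = allVecs (suc t') (cartesianProduct (allFin m) (allFin k))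
    G : Formula k m n → ℚ
    G Φ = sumOver choiceSeqs (λ cs → placed (i , j) J a y (Φ , cs))

  placed≡prob : ∀ p J a y ω → (var (at (proj₁ ω) p) ==F a) ≡ true → free a ≡ true → (flipped ω ==F y) ≡ true →
    eligible p J ω ≡ true → placed p J a y ω ≡ prob ω
  placed≡prob p J a y ω at-a free-a flipped-y elig rewrite at-a | free-a | flipped-y | elig = refl

  placed-own : ∀ p J ω → hitsAll (p ∷ J) ω ≡ true →
    placed p J (var (at (proj₁ ω) p)) (var (at (proj₁ ω) p)) ω ≡ prob ω
  placed-own p J ω h = placed≡prob p J v v ω (==F-refl v) free-v flipped-v elig
    where
    v = var (at (proj₁ ω) p)
    hit-p : hit p ω ≡ true
    hit-p = ∧-trueˡ (∧-trueʳ {informed ω} h)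
    hidden = piOf-sgn-true⇒ (proj₁ ω) (stateAt ω t') (proj₁ p) (proj₂ p) (∧-trueˡ hit-p)
    free-v : free v ≡ true
    free-v = cong not (trans (sameInfo⇒exploredBefore ω₀ ω (∧-trueˡ h) v) (proj₁ hidden))
    flipped-v : (flipped ω ==F v) ≡ true
    flipped-v = ∧-trueʳ {running ω} (∧-trueʳ {hiddenPositive p ω} hit-p)
    elig : eligible p J ω ≡ true
    elig = ∧-true {hitsAll J ω} (∧-true {informed ω} (∧-trueˡ h) (∧-trueʳ {hit p ω} (∧-trueʳ {informed ω} h)))
                  (∧-true {hiddenPositive p ω} (∧-trueˡ hit-p) (∧-trueˡ (∧-trueʳ {hiddenPositive p ω} hit-p)))

  weight-hitsAll-∷ : ∀ p J ω → weight (hitsAll (p ∷ J)) ω Q.≤ sum (λ y → placed p J y y ω)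
  weight-hitsAll-∷ p J ω = go (hitsAll (p ∷ J) ω) refl
    where
    go : ∀ b → hitsAll (p ∷ J) ω ≡ b → weight (hitsAll (p ∷ J)) ω Q.≤ sum (λ y → placed p J y y ω)
    go false h rewrite h = 0≤-sum n (λ y → 0≤-placed p J y y ω)
    go true h rewrite h = QP.≤-trans (QP.≤-reflexive (sym (placed-own p J ω h)))
                                     (term≤sum n (λ y → 0≤-placed p J y y ω) (var (at (proj₁ ω) p)))

  -- Position p carries exactly one variable, and exactly one variable is flipped at step t.
  sum-sum-placed : ∀ p J ω → sum (λ y → sum (λ a → placed p J a y ω)) Q.≤ weight (hitsAll J) ω
  sum-sum-placed p J ω = begin
    sum (λ y → sum (λ a → placed p J a y ω))
      ≤⟨ sum-mono n (λ y → sum-mono n (λ a → placed≤ a y)) ⟩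
    sum (λ y → sum (λ a → when (v ==F a) (when (flipped ω ==F y) W)))
      ≡⟨ sum-cong-≗ {n} (λ y → sum-when-==F n v (when (flipped ω ==F y) W)) ⟩
    sum (λ y → when (flipped ω ==F y) W)
      ≡⟨ sum-when-==F n (flipped ω) W ⟩
    W ∎
    where
    open QP.≤-Reasoning
    v = var (at (proj₁ ω) p)
    W = weight (hitsAll J) ω
    placed≤ : ∀ a y → placed p J a y ω Q.≤ when (v ==F a) (when (flipped ω ==F y) W)
    placed≤ a y = when-mono (v ==F a)
      (QP.≤-trans (when-≤ (free a) (0≤-when (flipped ω ==F y) (0≤-when (eligible p J ω) (prob-nonNeg ω))))
                  (when-mono (flipped ω ==F y) (when-⇒ {eligible p J ω} {hitsAll J ω} ∧-trueˡ (prob-nonNeg ω))))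

  U-sumOver-placed : ∀ p J → All (p ≢_) J → ∀ y →
    natℚ U Q.* sumOver outcomes (placed p J y y) Q.≤ sum (λ a → sumOver outcomes (placed p J a y))
  U-sumOver-placed p J p∉J y =
    QP.≤-trans (QP.≤-reflexive (sym (sum-when-count n free (sumOver outcomes (placed p J y y)))))
               (sum-mono n (λ a → each a (free a) refl))
    where
    each : ∀ a b → free a ≡ b → when b (sumOver outcomes (placed p J y y)) Q.≤ sumOver outcomes (placed p J a y)
    each a false _ = 0≤-sumOver outcomes (0≤-placed p J a y)
    each a true free-a = go (free y) refl
      where
      go : ∀ b → free y ≡ b → sumOver outcomes (placed p J y y) Q.≤ sumOver outcomes (placed p J a y)
      go true free-y = QP.≤-reflexive (sumOver-placed-transposeAt p J p∉J a y free-a free-y)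
      go false free-y = QP.≤-trans (QP.≤-reflexive (trans (sumOver-cong outcomes placed≡0) (sumOver-zero outcomes)))
                                   (0≤-sumOver outcomes (0≤-placed p J a y))
        where
        placed≡0 : ∀ ω → placed p J y y ω ≡ 0ℚ
        placed≡0 ω = trans (cong (λ b → when (var (at (proj₁ ω) p) ==F y) (when b (flipsTo p J y ω))) free-y)
                           (when-0 (var (at (proj₁ ω) p) ==F y))

  U-Pr-hitsAll-∷ : ∀ p J → All (p ≢_) J → natℚ U Q.* Pr (hitsAll (p ∷ J)) Q.≤ Pr (hitsAll J)
  U-Pr-hitsAll-∷ p J p∉J = begin
    natℚ U Q.* Pr (hitsAll (p ∷ J))
      ≤⟨ QP.*-monoˡ-≤-nonNeg (natℚ U) {{Q.nonNegative (0≤-natℚ U)}}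
                            (sumOver-mono outcomes (weight-hitsAll-∷ p J)) ⟩
    natℚ U Q.* sumOver outcomes (λ ω → sum (λ y → placed p J y y ω))
      ≡⟨ cong (natℚ U Q.*_) (sum-sumOver-comm n outcomes (λ y → placed p J y y)) ⟨
    natℚ U Q.* sum (λ y → sumOver outcomes (placed p J y y))
      ≡⟨ *-distribˡ-sum (natℚ U) (λ y → sumOver outcomes (placed p J y y)) ⟩
    sum (λ y → natℚ U Q.* sumOver outcomes (placed p J y y))
      ≤⟨ sum-mono n (U-sumOver-placed p J p∉J) ⟩
    sum (λ y → sum (λ a → sumOver outcomes (placed p J a y)))
      ≡⟨ sum-cong-≗ {n} (λ y → sum-sumOver-comm n outcomes (λ a → placed p J a y)) ⟩
    sum (λ y → sumOver outcomes (λ ω → sum (λ a → placed p J a y ω)))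
      ≡⟨ sum-sumOver-comm n outcomes (λ y ω → sum (λ a → placed p J a y ω)) ⟩
    sumOver outcomes (λ ω → sum (λ y → sum (λ a → placed p J a y ω)))
      ≤⟨ sumOver-mono outcomes (sum-sum-placed p J) ⟩
    Pr (hitsAll J) ∎
    where open QP.≤-Reasoning

  Pr-hitsAll-∷ : ∀ p J → Pr (hitsAll (p ∷ J)) Q.≤ Pr (hitsAll J)
  Pr-hitsAll-∷ p J = sumOver-mono outcomes λ ω → when-⇒ {hitsAll (p ∷ J) ω} {hitsAll J ω}
    (λ h → ∧-true (∧-trueˡ h) (∧-trueʳ {hit p ω} (∧-trueʳ {informed ω} h))) (prob-nonNeg ω)

  M : ℕ
  M = 1 ℕ.⊔ U

  M-Pr-hitsAll-∷ : ∀ p J → All (p ≢_) J → natℚ M Q.* Pr (hitsAll (p ∷ J)) Q.≤ Pr (hitsAll J)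
  M-Pr-hitsAll-∷ p J p∉J with U in U≡
  ... | zero = QP.≤-trans (QP.≤-reflexive (natℚ-1-* _)) (Pr-hitsAll-∷ p J)
  ... | suc _ = subst (λ u → natℚ u Q.* Pr (hitsAll (p ∷ J)) Q.≤ Pr (hitsAll J)) U≡ (U-Pr-hitsAll-∷ p J p∉J)

  M^-Pr-hitsAll : ∀ J → Unique J → natℚ (M ℕ.^ L.length J) Q.* Pr (hitsAll J) Q.≤ Pr (hitsAll [])
  M^-Pr-hitsAll [] _ = QP.≤-reflexive (natℚ-1-* _)
  M^-Pr-hitsAll (p ∷ J) (p∉J ∷ unique) = begin
    natℚ (M ℕ.^ suc (L.length J)) Q.* X
      ≡⟨ cong (Q._* X) (natℚ-* M (M ℕ.^ L.length J)) ⟩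
    (natℚ M Q.* natℚ (M ℕ.^ L.length J)) Q.* X
      ≡⟨ solve 3 (λ a b x → (a :* b) :* x := b :* (a :* x)) refl (natℚ M) (natℚ (M ℕ.^ L.length J)) X ⟩
    natℚ (M ℕ.^ L.length J) Q.* (natℚ M Q.* X)
      ≤⟨ QP.*-monoˡ-≤-nonNeg (natℚ (M ℕ.^ L.length J)) {{Q.nonNegative (0≤-natℚ (M ℕ.^ L.length J))}}
                            (M-Pr-hitsAll-∷ p J p∉J) ⟩
    natℚ (M ℕ.^ L.length J) Q.* Pr (hitsAll J)
      ≤⟨ M^-Pr-hitsAll J unique ⟩
    Pr (hitsAll []) ∎
    where
    open QP.≤-Reasoning
    X = Pr (hitsAll (p ∷ J))

  kstar-factor : (I : Fin m → Fin k → Bool) → Ω → Fin m × Fin k → ℚ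
  kstar-factor I ω (i , j) = if I i j then Kstar (suc t') ω i j else 1ℚ

  kstar-factor-01 : ∀ I ω q → kstar-factor I ω q ≡ 0ℚ ⊎ kstar-factor I ω q ≡ 1ℚ
  kstar-factor-01 I ω (i , j) with I i j | kstar (i , j) ω
  ... | false | _ = inj₂ refl
  ... | true | true = inj₂ refl
  ... | true | false = inj₁ refl

  kstar-factors-1⇒hit : ∀ I ω qs → All (λ q → kstar-factor I ω q ≡ 1ℚ) qs →
    BL.all (λ q → hit q ω) (filter (T? ∘ λ q → I (proj₁ q) (proj₂ q)) qs) ≡ true
  kstar-factors-1⇒hit I ω [] [] = refl
  kstar-factors-1⇒hit I ω ((i , j) ∷ qs) (factor≡1 ∷ factors≡1) with I i j | kstar (i , j) ω in kstar≡
  ... | false | _ = kstar-factors-1⇒hit I ω qs factors≡1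
  ... | true | true = ∧-true (kstar⇒hit (i , j) ω kstar≡) (kstar-factors-1⇒hit I ω qs factors≡1)

  0≤-prodKstar : ∀ I ω → 0ℚ Q.≤ prodKstar I ω
  0≤-prodKstar I ω with prodℚ-01 (kstar-factor I ω) (positions m k) (kstar-factor-01 I ω)
  ... | inj₁ ≡0 = QP.≤-reflexive (sym ≡0)
  ... | inj₂ (≡1 , _) = subst (0ℚ Q.≤_) (sym ≡1) 0≤1

  -- K*-products vanish unless every selected position is hit
  weight-prodKstar : ∀ I ω → when (informed ω) (prob ω Q.* prodKstar I ω) Q.≤ weight (hitsAll (positionsIn I)) ω
  weight-prodKstar I ω with informed ω
  ... | false = QP.≤-refl
  ... | true with prodℚ-01 (kstar-factor I ω) (positions m k) (kstar-factor-01 I ω)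
  ...   | inj₁ ≡0 = QP.≤-trans (QP.≤-reflexive (trans (cong (prob ω Q.*_) ≡0) (QP.*-zeroʳ (prob ω))))
                                (0≤-when (BL.all (λ q → hit q ω) (positionsIn I)) (prob-nonNeg ω))
  ...   | inj₂ (≡1 , factors≡1) rewrite kstar-factors-1⇒hit I ω (positions m k) factors≡1 =
            QP.≤-reflexive (trans (cong (prob ω Q.*_) ≡1) (QP.*-identityʳ (prob ω)))

  M^-numerator : ∀ I →
    natℚ (M ℕ.^ ∣ I ∣ᵢ) Q.* sumOver outcomes (λ ω → when (informed ω) (prob ω Q.* prodKstar I ω))
      Q.≤ Pr informed
  M^-numerator I = begin
    natℚ (M ℕ.^ ∣ I ∣ᵢ) Q.* sumOver outcomes (λ ω → when (informed ω) (prob ω Q.* prodKstar I ω))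
      ≤⟨ QP.*-monoˡ-≤-nonNeg (natℚ (M ℕ.^ ∣ I ∣ᵢ)) {{Q.nonNegative (0≤-natℚ (M ℕ.^ ∣ I ∣ᵢ))}}
                            (sumOver-mono outcomes (weight-prodKstar I)) ⟩
    natℚ (M ℕ.^ ∣ I ∣ᵢ) Q.* Pr (hitsAll (positionsIn I))
      ≡⟨ cong (λ e → natℚ (M ℕ.^ e) Q.* Pr (hitsAll (positionsIn I))) (length-positionsIn I) ⟨
    natℚ (M ℕ.^ L.length (positionsIn I)) Q.* Pr (hitsAll (positionsIn I))
      ≤⟨ M^-Pr-hitsAll (positionsIn I) (positionsIn-unique I) ⟩
    Pr (hitsAll [])
      ≡⟨ sumOver-cong outcomes (λ ω → cong (λ b → when b (prob ω)) (BP.∧-identityʳ (informed ω))) ⟩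
    Pr informed ∎
    where open QP.≤-Reasoning

  condExp≤bound : ∀ I → condExp k m n (suc t') t' (prodKstar I) ω₀ Q.≤ bound (suc t') I ω₀
  condExp≤bound I with Pr informed Q.≟ 0ℚ
  ... | yes _ = 0≤-recipℕ (M ℕ.^ ∣ I ∣ᵢ)   -- condExp is 0 on a null atom
  ... | no Pr≢0 =
    ÷≤recipℕ _ _ (M ℕ.^ ∣ I ∣ᵢ) (ℕP.m^n>0 M {{ℕ.>-nonZero (ℕP.m≤m⊔n 1 U)}} ∣ I ∣ᵢ)
      (0≤-sumOver outcomes (λ ω → 0≤-when (informed ω) (0≤-* (prob-nonNeg ω) (0≤-prodKstar I ω))))
      (0≤-sumOver outcomes (λ ω → 0≤-when (informed ω) (prob-nonNeg ω)))
      Pr≢0 (M^-numerator I)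

-- The bound holds for all k, n, ρ, m.
corollary1 : ∃[ k₀ ] ∀ (k : ℕ) → k₀ ≤ k → ∀ (n : ℕ) (ρ : ℚ) →
    recipℕ (k * k) Q.≤ ρ → ρ < recipℕ 25 →
    ∀ (m : ℕ) → + m ≡ ceiling (ρ Q.* (+ (2 ^ k * n) / 1) Q.* recipℕ k) →
    ∀ (t : ℕ) → 1 ≤ t → ∀ (I : Fin m → Fin k → Bool) (ω : Outcome k m n t) →
    0ℚ < prob ω →
    condExp k m n t (t Data.Nat.∸ 1) (prodKstar I) ω Q.≤ bound t I ω
corollary1 = 0 , λ { k _ n ρ _ _ m _ (suc t') _ I ω _ → SwapArgument.condExp≤bound ω I }
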